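{- Let $\mathbf{t}$ be the Tribonacci word and $F_k=|\varphi^k(0)|$. For $i\in\mathbb{N}$ let $M_i$ be the positive integer whose normal $F$-representation is $((1,0,0,0)^i,0)$, i.e. $i$ copies of the block $(1,0,0,0)$ followed by a final digit $0$; thus $M_i=\sum_{j=1}^{i}F_{4j}$. Then for all $i\ge3$, $$\mathcal{P}^{\mathrm{rel}}_{\mathbf{t}}(M_i)=\{(0,0,0),(0,-1,1),(1,-1,0),(1,0,-1),(0,1,-1),(-1,0,1)\},$$ and therefore $\mathrm{AC}_{\mathbf{t}}(M_i)=6$ for all $i\ge3$. Consequently, the abelian complexity of the Tribonacci word attains the value $6$ infinitely many times.
   Context: The Tribonacci word $\mathbf{t}=\lim_{k\to\infty}\varphi^k(0)$ is the fixed point of the substitution $\varphi$ on $\{0,1,2\}^*$ given by $0\mapsto 01$, $1\mapsto 02$, $2\mapsto 0$; $F_k=|\varphi^k(0)|$. The normal $F$-representation of $n\in\mathbb{N}_0$ is the digit string $(d_N,\dots,d_0)$ with $n=\sum_i d_iF_i$ obtained by the greedy algorithm: choose $N$ with $n<F_{N+1}$, set $x_N=n$, and for $i=N,\dots,0$ put $d_i=\lfloor x_i/F_i\rfloor$, $x_{i-1}=x_i-d_iF_i$. For a finite word $w$, $\Psi(w)=(|w|_0,|w|_1,|w|_2)$ is its Parikh vector ($|w|_\ell$ = number of occurrences of $\ell$ in $w$). Let $\mathbf{t}_{[n]}$ denote the prefix of $\mathbf{t}$ of length $n$. For a factor $w$ of $\mathbf{t}$ of length $n$, its relative Parikh vector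 is $\Psi^{\mathrm{rel}}(w)=\Psi(w)-\Psi(\mathbf{t}_{[n]})$, and $\mathcal{P}^{\mathrm{rel}}_{\mathbf{t}}(n)=\{\Psi^{\mathrm{rel}}(w): w \text{ a factor of }\mathbf{t},\ |w|=n\}$. The abelian complexity is $\mathrm{AC}_{\mathbf{t}}(n)=\#\{\Psi(w): w\text{ a factor of }\mathbf{t},\ |w|=n\}$. -}

module Defs where

open import Data.Nat using (ℕ; zero; suc; _+_; _*_)
open import Data.Fin using (Fin; zero; suc)
open import Data.List using (List; []; _∷_; _++_; concatMap; length; take; drop; filterᵇ)
open import Data.List.Membership.Propositional using (_∈_)
open import Data.List.Relation.Unary.Unique.Propositional using (Unique)
open import Data.Integer using (ℤ; +_; _-_)
open import Data.Product using (_×_; _,_; ∃-syntax)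
open import Data.Bool using (Bool; true; false)
open import Function.Bundles using (_⇔_)
open import Relation.Binary.PropositionalEquality using (_≡_)

Letter : Set
Letter = Fin 3

φ₁ : Letter → List Letter
φ₁ zero = zero ∷ suc zero ∷ []
φ₁ (suc zero) = zero ∷ suc (suc zero) ∷ []
φ₁ (suc (suc zero)) = zero ∷ []

φ : List Letter → List Letter
φ = concatMap φ₁

φ^_[0] : ℕ → List Letter
φ^ zero [0] = zero ∷ []
φ^ suc k [0] = φ (φ^ k [0])

F : ℕ → ℕ
F k = length (φ^ k [0])

-- Since φ^k(0) is a prefix of φ^(k+1)(0) and |φ^k(0)| ≥ k+1, the prefix of
-- t of length n is the prefix of φ^n(0) of length n.
prefix : ℕ → List Letter
prefix n = take n (φ^ n [0])

factorAt : ℕ → ℕ → List Letter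
factorAt i n = take n (drop i (φ^ (i + n) [0]))

IsFactorOfLength : ℕ → List Letter → Set
IsFactorOfLength n w = ∃[ i ] (w ≡ factorAt i n)

eqL : Letter → Letter → Bool
eqL zero zero = true
eqL (suc zero) (suc zero) = true
eqL (suc (suc zero)) (suc (suc zero)) = true
eqL _ _ = false

count : Letter → List Letter → ℕ
count a w = length (filterᵇ (eqL a) w)

Vec3 : Set
Vec3 = ℤ × ℤ × ℤ

Ψ : List Letter → Vec3
Ψ w = (+ count zero w , + count (suc zero) w , + count (suc (suc zero)) w)

_-₃_ : Vec3 → Vec3 → Vec3
(a , b , c) -₃ (a' , b' , c') = (a - a' , b - b' , c - c')

Ψrel : List Letter → Vec3
Ψrel w = Ψ w -₃ Ψ (prefix (length w))

InPrel : ℕ → Vec3 → Set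
InPrel n v = ∃[ w ] (IsFactorOfLength n w × Ψrel w ≡ v)

InParikhSet : ℕ → Vec3 → Set
InParikhSet n v = ∃[ w ] (IsFactorOfLength n w × Ψ w ≡ v)

AC≡ : ℕ → ℕ → Set
AC≡ n k = ∃[ L ] (Unique L × length L ≡ k × (∀ v → (v ∈ L) ⇔ InParikhSet n v))

M : ℕ → ℕ
M zero = 0
M (suc i) = M i + F (4 * suc i)

six : List Vec3
six = (+ 0 , + 0 , + 0)
    ∷ (+ 0 , Data.Integer.-[1+ 0 ] , + 1)
    ∷ (+ 1 , Data.Integer.-[1+ 0 ] , + 0)
    ∷ (+ 1 , + 0 , Data.Integer.-[1+ 0 ])
    ∷ (+ 0 , + 1 , Data.Integer.-[1+ 0 ])
    ∷ (Data.Integer.-[1+ 0 ] , + 0 , + 1)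
    ∷ []

-- A factor of t of length m at position q is described by a finite state
-- σ = (a , v , w): its first letter a = t_q, its relative Parikh vector
-- v = Ψ(t[q,q+m)) − Ψ(t[0,m)), and a window w of t read from position
-- q+m−1 ('Describes').  Applying φ to t[0,q+m) yields the factors of length
-- |φ(t[0,m))|, and the state of each of them is computed from σ alone
-- ('step-sound').  Every position of t has a preimage under φ
-- ('decompose'), so a finite set of states closed under steps covers all
-- positions again ('cover-step').  Since t[0,M_{i+1}) = φ⁴(t[0,M_i) 0), the
-- lengths M_i are reached by appending the letter 0 ('extend-sound') and
-- four steps.  Starting from the length-4 factors of t ('windows'), five
-- computed lists of states P0, P1, P2, P3, PR cover all positions at
-- lengths M_i + 1 resp. M_{i+1}, and the vectors in PR lie in 'six'.
-- Conversely, explicit witness states, closed under one round, realise each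
-- vector of 'six' at every length M_i with i ≥ 3 ('witnessed').  Hence
-- P^rel(M_i) = six ('relative-M'); translating by Ψ(t[0,n)) turns this into
-- AC(M_i) = 6 ('abelian-complexity'), and M_i ≥ i gives infinitely many n.

module Submission where

open import Defs
open import Data.Nat using (ℕ; zero; suc; _+_; _*_; _≤_; _<_; z≤n; s≤s; pred)
open import Data.Nat.Properties
  using (≤-trans; ≤-refl; ≤-reflexive; n≤1+n; ≤-pred; m≤n⇒m⊓n≡m; +-comm; +-assoc; +-suc;
         +-identityʳ; m≤m+n; m≤n+m; <⇒≤; suc-injective; +-cancelˡ-≡; +-cancelʳ-≡; +-mono-≤; *-suc;
         ≤-antisym; <-irrefl; _≤?_; _<?_; ≰⇒>)
open import Data.Nat.Induction using (<-rec)
open import Data.Integer using (ℤ; +_; -[1+_]) renaming (_+_ to _+ᶻ_; _-_ to _-ᶻ_)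
open import Data.Integer.Properties using (pos-+; +-injective) renaming (_≟_ to _≟ᶻ_)
open import Data.Integer.Tactic.RingSolver using (solve-∀)
open import Data.Fin using (Fin; zero; suc; toℕ; fromℕ<)
open import Data.Fin.Properties using (toℕ-fromℕ<) renaming (_≟_ to _≟ˡ_; all? to all-Fin?)
open import Data.Bool using (true; false)
open import Data.Empty using (⊥; ⊥-elim)
open import Data.Product using (_×_; _,_; ∃-syntax; proj₁; proj₂)
open import Data.Product.Properties using () renaming (≡-dec to ≡-dec-×)
open import Data.Maybe using (Maybe; just; nothing; _>>=_)
open import Data.Maybe.Properties using () renaming (≡-dec to ≡-dec-Maybe)
open import Data.Maybe.Relation.Unary.Any using (just) renaming (Any to Lands)
import Data.Maybe.Relation.Unary.Any as Lands
open import Data.Vec using (Vec; []; _∷_)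
open import Data.List using (List; []; _∷_; _++_; length; take; drop; map)
open import Data.List.Properties
  using (length-++; ++-assoc; ++-identityʳ; take++drop≡id; length-take; take-all; take-[];
         concatMap-++; ∷-injectiveˡ; ++-cancelˡ; length-map)
  renaming (≡-dec to ≡-dec-List)
open import Data.List.Membership.Propositional using (_∈_; find)
open import Data.List.Membership.Propositional.Properties using (∈-map⁻; ∈-map⁺)
import Data.List.Membership.DecPropositional as DecMembership
open import Data.List.Relation.Unary.All using (All; all?) renaming (lookup to All-lookup)
open import Data.List.Relation.Unary.Any using (Any; any?)
open import Data.List.Relation.Unary.Unique.Propositional using (Unique)
import Data.List.Relation.Unary.Unique.Propositional.Properties as Unique
import Data.List.Relation.Unary.Unique.DecPropositional as DecUnique
open import Function.Bundles using (_⇔_; mk⇔; Equivalence)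
open import Relation.Binary using (DecidableEquality)
open import Relation.Nullary using (Dec; yes; no; _×-dec_)
open import Relation.Nullary.Decidable using (from-yes)
open import Relation.Binary.PropositionalEquality

private
  variable
    u v w : List Letter

infix 4 _⊑_
_⊑_ : List Letter → List Letter → Set
u ⊑ v = ∃[ w ] (v ≡ u ++ w)

⊑-trans : u ⊑ v → v ⊑ w → u ⊑ w
⊑-trans {u} (x , refl) (y , refl) = x ++ y , ++-assoc u x y

take-⊑ : ∀ n u → take n u ⊑ u
take-⊑ n u = drop n u , sym (take++drop≡id n u)

++⁺-⊑ : ∀ u → v ⊑ w → u ++ v ⊑ u ++ w
++⁺-⊑ u (x , refl) = x , sym (++-assoc u _ x)

take-of-⊑ : ∀ n x → x ⊑ v → n ≤ length x → take n v ≡ take n x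
take-of-⊑ zero    x       _          _       = refl
take-of-⊑ (suc n) (a ∷ x) (y , refl) (s≤s h) = cong (a ∷_) (take-of-⊑ n x (y , refl) h)

φ-++ : ∀ u v → φ (u ++ v) ≡ φ u ++ φ v
φ-++ = concatMap-++ φ₁

φ-snoc : ∀ u a → φ (u ++ a ∷ []) ≡ φ u ++ φ₁ a
φ-snoc u a = trans (φ-++ u (a ∷ [])) (cong (φ u ++_) (++-identityʳ (φ₁ a)))

φ-⊑ : u ⊑ v → φ u ⊑ φ v
φ-⊑ {u} (x , refl) = φ x , φ-++ u x

length-φ : ∀ u → length u ≤ length (φ u)
length-φ []                    = z≤n
length-φ (zero ∷ u)            = ≤-trans (n≤1+n _) (s≤s (s≤s (length-φ u)))
length-φ (suc zero ∷ u)        = ≤-trans (n≤1+n _) (s≤s (s≤s (length-φ u)))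
length-φ (suc (suc zero) ∷ u)  = s≤s (length-φ u)

φ^-⊑-suc : ∀ k → φ^ k [0] ⊑ φ^ suc k [0]
φ^-⊑-suc zero    = suc zero ∷ [] , refl
φ^-⊑-suc (suc k) = φ-⊑ (φ^-⊑-suc k)

φ^-⊑ : ∀ a b → φ^ a [0] ⊑ φ^ (b + a) [0]
φ^-⊑ a zero    = [] , sym (++-identityʳ _)
φ^-⊑ a (suc b) = ⊑-trans (φ^-⊑ a b) (φ^-⊑-suc (b + a))

φ^-head : ∀ k → ∃[ r ] (φ^ k [0] ≡ zero ∷ r)
φ^-head zero    = [] , refl
φ^-head (suc k) with φ^-head k
... | r , eq rewrite eq = suc zero ∷ φ r , refl

F-grows : ∀ k → suc k ≤ F k
F-grows zero    = s≤s z≤n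
F-grows (suc k) with φ^-head k
... | r , eq rewrite eq =
  s≤s (s≤s (≤-trans (≤-pred (subst (λ y → suc k ≤ length y) eq (F-grows k))) (length-φ r)))

n≤F : ∀ n → n ≤ F n
n≤F n = ≤-trans (n≤1+n n) (F-grows n)

IsTPrefix : List Letter → Set
IsTPrefix u = prefix (length u) ≡ u

⊑φ^⇒IsTPrefix : ∀ k → u ⊑ φ^ k [0] → IsTPrefix u
⊑φ^⇒IsTPrefix {u} k p = trans short long
  where
  n : ℕ
  n = length u
  short : take n (φ^ n [0]) ≡ take n (φ^ (k + n) [0])
  short = sym (take-of-⊑ n (φ^ n [0]) (φ^-⊑ n k) (n≤F n))
  long : take n (φ^ (k + n) [0]) ≡ u
  long = trans (take-of-⊑ n u (⊑-trans p (subst (λ j → φ^ k [0] ⊑ φ^ j [0]) (+-comm n k) (φ^-⊑ k n))) ≤-refl)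
               (take-all n u ≤-refl)

IsTPrefix⇒⊑φ^ : IsTPrefix v → v ⊑ φ^ (length v) [0]
IsTPrefix⇒⊑φ^ {v} eq = subst (_⊑ φ^ (length v) [0]) eq (take-⊑ (length v) _)

IsTPrefix-⊑ : u ⊑ v → IsTPrefix v → IsTPrefix u
IsTPrefix-⊑ {v = v} p q = ⊑φ^⇒IsTPrefix (length v) (⊑-trans p (IsTPrefix⇒⊑φ^ q))

-- t is a fixed point of φ.
IsTPrefix-φ : IsTPrefix u → IsTPrefix (φ u)
IsTPrefix-φ {u} q = ⊑φ^⇒IsTPrefix (suc (length u)) (φ-⊑ (IsTPrefix⇒⊑φ^ q))

length-prefix : ∀ n → length (prefix n) ≡ n
length-prefix n = trans (length-take n (φ^ n [0])) (m≤n⇒m⊓n≡m (n≤F n))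

prefix-IsTPrefix : ∀ n → IsTPrefix (prefix n)
prefix-IsTPrefix n = cong prefix (length-prefix n)

IsTPrefix⇒prefix : ∀ n → IsTPrefix u → length u ≡ n → prefix n ≡ u
IsTPrefix⇒prefix n q refl = q

IsTPrefix-extend : IsTPrefix u → ∃[ a ] IsTPrefix (u ++ a ∷ [])
IsTPrefix-extend {u} q with IsTPrefix⇒⊑φ^ q
... | a ∷ y , eq = a , ⊑φ^⇒IsTPrefix (length u) (y , trans eq (sym (++-assoc u (a ∷ []) y)))
... | [] , eq = ⊥-elim (<-irrefl refl
        (subst (λ z → length u < length z) (trans eq (++-identityʳ u)) (F-grows (length u))))

IsTPrefix-letter-unique : ∀ u {a b} → IsTPrefix (u ++ a ∷ []) → IsTPrefix (u ++ b ∷ []) → a ≡ b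
IsTPrefix-letter-unique u ha hb =
  ∷-injectiveˡ (++-cancelˡ u _ _ (trans (sym ha) (trans (cong prefix (trans (length-++ u) (sym (length-++ u)))) hb)))

OccursAt : ℕ → List Letter → Set
OccursAt p w = IsTPrefix (prefix p ++ w)

occurs-⊑ : ∀ p → v ⊑ w → OccursAt p w → OccursAt p v
occurs-⊑ p h = IsTPrefix-⊑ (++⁺-⊑ (prefix p) h)

prefix-++ : ∀ u w j → IsTPrefix (u ++ w) → j ≤ length w → prefix (length u + j) ≡ u ++ take j w
prefix-++ u w j h hj = IsTPrefix⇒prefix _ (IsTPrefix-⊑ (++⁺-⊑ u (take-⊑ j w)) h)
  (trans (length-++ u) (cong (_+_ (length u)) (trans (length-take j w) (m≤n⇒m⊓n≡m hj))))

take-+ : ∀ i n (y : List Letter) → take (i + n) y ≡ take i y ++ take n (drop i y)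
take-+ zero    n y       = refl
take-+ (suc i) n []      = sym (take-[] n)
take-+ (suc i) n (a ∷ y) = cong (a ∷_) (take-+ i n y)

prefix-split : ∀ i n → prefix (i + n) ≡ prefix i ++ factorAt i n
prefix-split i n = trans (take-+ i n y) (cong (_++ factorAt i n) (sym prefix-i))
  where
  y : List Letter
  y = φ^ (i + n) [0]
  prefix-i : prefix i ≡ take i y
  prefix-i = IsTPrefix⇒prefix i (⊑φ^⇒IsTPrefix (i + n) (take-⊑ i y))
    (trans (length-take i y) (m≤n⇒m⊓n≡m (≤-trans (m≤m+n i n) (n≤F (i + n)))))

length-factorAt : ∀ i n → length (factorAt i n) ≡ n
length-factorAt i n = +-cancelˡ-≡ i _ _ (begin
  i + length (factorAt i n)              ≡⟨ cong (_+ length (factorAt i n)) (sym (length-prefix i)) ⟩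
  length (prefix i) + length (factorAt i n) ≡⟨ sym (length-++ (prefix i)) ⟩
  length (prefix i ++ factorAt i n)      ≡⟨ cong length (sym (prefix-split i n)) ⟩
  length (prefix (i + n))                ≡⟨ length-prefix (i + n) ⟩
  i + n                                  ∎)
  where open ≡-Reasoning

_+₃_ : Vec3 → Vec3 → Vec3
(a , b , c) +₃ (a' , b' , c') = (a +ᶻ a' , b +ᶻ b' , c +ᶻ c')

cong₃ : ∀ {a b c a' b' c' : ℤ} → a ≡ a' → b ≡ b' → c ≡ c' → (a , b , c) ≡ (a' , b' , c')
cong₃ refl refl refl = refl

π₀ π₁ π₂ : Vec3 → ℤ
π₀ = proj₁
π₁ x = proj₁ (proj₂ x)
π₂ x = proj₂ (proj₂ x)

move-summand : ∀ y c s v → y +₃ c ≡ s +₃ v → y ≡ s +₃ (v -₃ c)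
move-summand (y₀ , y₁ , y₂) (c₀ , c₁ , c₂) (s₀ , s₁ , s₂) (v₀ , v₁ , v₂) h =
  cong₃ (move y₀ c₀ s₀ v₀ (cong π₀ h)) (move y₁ c₁ s₁ v₁ (cong π₁ h)) (move y₂ c₂ s₂ v₂ (cong π₂ h))
  where
  cancel : ∀ y c → y ≡ (y +ᶻ c) -ᶻ c
  cancel = solve-∀
  reassoc : ∀ s v c → (s +ᶻ v) -ᶻ c ≡ s +ᶻ (v -ᶻ c)
  reassoc = solve-∀
  move : ∀ y c s v → y +ᶻ c ≡ s +ᶻ v → y ≡ s +ᶻ (v -ᶻ c)
  move y c s v h = trans (cancel y c) (trans (cong (_-ᶻ c) h) (reassoc s v c))

+₃-cancelˡ : ∀ c x y → c +₃ x ≡ c +₃ y → x ≡ y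
+₃-cancelˡ (c₀ , c₁ , c₂) (x₀ , x₁ , x₂) (y₀ , y₁ , y₂) h =
  cong₃ (cancel c₀ x₀ y₀ (cong π₀ h)) (cancel c₁ x₁ y₁ (cong π₁ h)) (cancel c₂ x₂ y₂ (cong π₂ h))
  where
  unadd : ∀ c x → x ≡ (c +ᶻ x) -ᶻ c
  unadd = solve-∀
  cancel : ∀ c x y → c +ᶻ x ≡ c +ᶻ y → x ≡ y
  cancel c x y h = trans (unadd c x) (trans (cong (_-ᶻ c) h) (sym (unadd c y)))

+₃-assoc : ∀ x y z → (x +₃ y) +₃ z ≡ x +₃ (y +₃ z)
+₃-assoc (x₀ , x₁ , x₂) (y₀ , y₁ , y₂) (z₀ , z₁ , z₂) = cong₃ (assoc x₀ y₀ z₀) (assoc x₁ y₁ z₁) (assoc x₂ y₂ z₂)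
  where
  assoc : ∀ x y z → (x +ᶻ y) +ᶻ z ≡ x +ᶻ (y +ᶻ z)
  assoc = solve-∀

add-sub : ∀ z x → x ≡ z +₃ (x -₃ z)
add-sub (z₀ , z₁ , z₂) (x₀ , x₁ , x₂) = cong₃ (identity z₀ x₀) (identity z₁ x₁) (identity z₂ x₂)
  where
  identity : ∀ z x → x ≡ z +ᶻ (x -ᶻ z)
  identity = solve-∀

-- Ψ(φ u) = A₃ Ψ(u) for the incidence matrix A₃ of φ, and |φ u| = ℓ₃ Ψ(u).
A₃ : Vec3 → Vec3
A₃ (a , b , c) = (a +ᶻ b +ᶻ c , a , b)

ℓ₃ : Vec3 → ℤ
ℓ₃ (a , b , c) = a +ᶻ a +ᶻ b +ᶻ b +ᶻ c

A₃-+ : ∀ x y → A₃ (x +₃ y) ≡ A₃ x +₃ A₃ y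
A₃-+ (a , b , c) (a' , b' , c') = cong₃ (linear a b c a' b' c') refl refl
  where
  linear : ∀ a b c a' b' c' → (a +ᶻ a') +ᶻ (b +ᶻ b') +ᶻ (c +ᶻ c') ≡ (a +ᶻ b +ᶻ c) +ᶻ (a' +ᶻ b' +ᶻ c')
  linear = solve-∀

ℓ₃-+ : ∀ x y → ℓ₃ (x +₃ y) ≡ ℓ₃ x +ᶻ ℓ₃ y
ℓ₃-+ (a , b , c) (a' , b' , c') = linear a b c a' b' c'
  where
  linear : ∀ a b c a' b' c' →
    (a +ᶻ a') +ᶻ (a +ᶻ a') +ᶻ (b +ᶻ b') +ᶻ (b +ᶻ b') +ᶻ (c +ᶻ c') ≡ (a +ᶻ a +ᶻ b +ᶻ b +ᶻ c) +ᶻ (a' +ᶻ a' +ᶻ b' +ᶻ b' +ᶻ c')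
  linear = solve-∀

e : Letter → Vec3
e a = Ψ (a ∷ [])

count-++ : ∀ a u v → count a (u ++ v) ≡ count a u + count a v
count-++ a []      v = refl
count-++ a (b ∷ u) v with eqL a b
... | true  = cong suc (count-++ a u v)
... | false = count-++ a u v

Ψ-++ : ∀ u v → Ψ (u ++ v) ≡ Ψ u +₃ Ψ v
Ψ-++ u v = cong₃ (additive zero) (additive (suc zero)) (additive (suc (suc zero)))
  where
  additive : ∀ a → + count a (u ++ v) ≡ + count a u +ᶻ + count a v
  additive a = trans (cong +_ (count-++ a u v)) (pos-+ (count a u) (count a v))

Ψ-φ : ∀ u → Ψ (φ u) ≡ A₃ (Ψ u)
Ψ-φ []      = refl
Ψ-φ (a ∷ u) = begin
  Ψ (φ₁ a ++ φ u)              ≡⟨ Ψ-++ (φ₁ a) (φ u) ⟩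
  Ψ (φ₁ a) +₃ Ψ (φ u)          ≡⟨ cong₂ _+₃_ (letter a) (Ψ-φ u) ⟩
  A₃ (e a) +₃ A₃ (Ψ u)         ≡⟨ sym (A₃-+ (e a) (Ψ u)) ⟩
  A₃ (e a +₃ Ψ u)              ≡⟨ cong A₃ (sym (Ψ-++ (a ∷ []) u)) ⟩
  A₃ (Ψ (a ∷ u))               ∎
  where
  open ≡-Reasoning
  letter : ∀ a → Ψ (φ₁ a) ≡ A₃ (e a)
  letter zero             = refl
  letter (suc zero)       = refl
  letter (suc (suc zero)) = refl

length-φ₁-ℓ₃ : ∀ a → + length (φ₁ a) ≡ ℓ₃ (e a)
length-φ₁-ℓ₃ zero             = refl
length-φ₁-ℓ₃ (suc zero)       = refl
length-φ₁-ℓ₃ (suc (suc zero)) = refl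

length-φ-ℓ₃ : ∀ u → + length (φ u) ≡ ℓ₃ (Ψ u)
length-φ-ℓ₃ []      = refl
length-φ-ℓ₃ (a ∷ u) = begin
  + length (φ₁ a ++ φ u)                ≡⟨ cong +_ (length-++ (φ₁ a)) ⟩
  + (length (φ₁ a) + length (φ u))      ≡⟨ pos-+ (length (φ₁ a)) _ ⟩
  + length (φ₁ a) +ᶻ + length (φ u)     ≡⟨ cong₂ _+ᶻ_ (length-φ₁-ℓ₃ a) (length-φ-ℓ₃ u) ⟩
  ℓ₃ (e a) +ᶻ ℓ₃ (Ψ u)                  ≡⟨ sym (ℓ₃-+ (e a) (Ψ u)) ⟩
  ℓ₃ (e a +₃ Ψ u)                       ≡⟨ cong ℓ₃ (sym (Ψ-++ (a ∷ []) u)) ⟩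
  ℓ₃ (Ψ (a ∷ u))                        ∎
  where open ≡-Reasoning

step-identity : ∀ y c x z v P S → y +₃ c ≡ (x +₃ z) +₃ v →
  A₃ y +₃ S ≡ ((A₃ x +₃ P) +₃ A₃ z) +₃ ((A₃ (v -₃ c) -₃ P) +₃ S)
step-identity y c x z v P S h = begin
  A₃ y +₃ S                                         ≡⟨ cong (λ y′ → A₃ y′ +₃ S) (move-summand y c (x +₃ z) v h) ⟩
  A₃ ((x +₃ z) +₃ (v -₃ c)) +₃ S                    ≡⟨ cong (_+₃ S) (A₃-+ (x +₃ z) (v -₃ c)) ⟩
  (A₃ (x +₃ z) +₃ A₃ (v -₃ c)) +₃ S                 ≡⟨ cong (λ t → (t +₃ A₃ (v -₃ c)) +₃ S) (A₃-+ x z) ⟩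
  ((A₃ x +₃ A₃ z) +₃ A₃ (v -₃ c)) +₃ S              ≡⟨ regroup (A₃ x) (A₃ z) (A₃ (v -₃ c)) P S ⟩
  ((A₃ x +₃ P) +₃ A₃ z) +₃ ((A₃ (v -₃ c) -₃ P) +₃ S) ∎
  where
  open ≡-Reasoning
  regroupᶻ : ∀ a b w P S → ((a +ᶻ b) +ᶻ w) +ᶻ S ≡ ((a +ᶻ P) +ᶻ b) +ᶻ ((w -ᶻ P) +ᶻ S)
  regroupᶻ = solve-∀
  regroup : ∀ a b w P S → ((a +₃ b) +₃ w) +₃ S ≡ ((a +₃ P) +₃ b) +₃ ((w -₃ P) +₃ S)
  regroup (a₀ , a₁ , a₂) (b₀ , b₁ , b₂) (w₀ , w₁ , w₂) (P₀ , P₁ , P₂) (S₀ , S₁ , S₂) =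
    cong₃ (regroupᶻ a₀ b₀ w₀ P₀ S₀) (regroupᶻ a₁ b₁ w₁ P₁ S₁) (regroupᶻ a₂ b₂ w₂ P₂ S₂)

step-length : ∀ X Y Z c v r s → Ψ Y +₃ e c ≡ (Ψ X +₃ Ψ Z) +₃ v →
  (+ (length (φ₁ c) + r)) -ᶻ ℓ₃ v ≡ + suc s →
  (length (φ X) + r) + length (φ Z) ≡ length (φ Y) + suc s
step-length X Y Z c v r s hΨ hs = +-injective (begin
  + ((lX + r) + lZ)             ≡⟨ pos-+ (lX + r) lZ ⟩
  + (lX + r) +ᶻ + lZ            ≡⟨ cong (_+ᶻ + lZ) (pos-+ lX r) ⟩
  (+ lX +ᶻ + r) +ᶻ + lZ         ≡⟨ combine (+ lX) (+ lZ) (+ lY) (+ lc) (+ r) (ℓ₃ v) (+ suc s) lengths sizes ⟩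
  + lY +ᶻ + suc s               ≡⟨ sym (pos-+ lY (suc s)) ⟩
  + (lY + suc s)                ∎)
  where
  open ≡-Reasoning
  lX lY lZ lc : ℕ
  lX = length (φ X)
  lY = length (φ Y)
  lZ = length (φ Z)
  lc = length (φ₁ c)
  lengths : + lY +ᶻ + lc ≡ (+ lX +ᶻ + lZ) +ᶻ ℓ₃ v
  lengths = begin
    + lY +ᶻ + lc                          ≡⟨ cong₂ _+ᶻ_ (length-φ-ℓ₃ Y) (length-φ₁-ℓ₃ c) ⟩
    ℓ₃ (Ψ Y) +ᶻ ℓ₃ (e c)                  ≡⟨ sym (ℓ₃-+ (Ψ Y) (e c)) ⟩
    ℓ₃ (Ψ Y +₃ e c)                       ≡⟨ cong ℓ₃ hΨ ⟩
    ℓ₃ ((Ψ X +₃ Ψ Z) +₃ v)                ≡⟨ trans (ℓ₃-+ (Ψ X +₃ Ψ Z) v) (cong (_+ᶻ ℓ₃ v) (ℓ₃-+ (Ψ X) (Ψ Z))) ⟩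
    (ℓ₃ (Ψ X) +ᶻ ℓ₃ (Ψ Z)) +ᶻ ℓ₃ v        ≡⟨ cong (_+ᶻ ℓ₃ v) (sym (cong₂ _+ᶻ_ (length-φ-ℓ₃ X) (length-φ-ℓ₃ Z))) ⟩
    (+ lX +ᶻ + lZ) +ᶻ ℓ₃ v                ∎
  sizes : (+ lc +ᶻ + r) -ᶻ ℓ₃ v ≡ + suc s
  sizes = trans (cong (_-ᶻ ℓ₃ v) (sym (pos-+ lc r))) hs
  cancel : ∀ Y C → Y ≡ (Y +ᶻ C) -ᶻ C
  cancel = solve-∀
  rearrange : ∀ X Z C R L → (X +ᶻ R) +ᶻ Z ≡ ((X +ᶻ Z) +ᶻ L -ᶻ C) +ᶻ ((C +ᶻ R) -ᶻ L)
  rearrange = solve-∀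
  combine : ∀ X Z Y C R L S → Y +ᶻ C ≡ (X +ᶻ Z) +ᶻ L → (C +ᶻ R) -ᶻ L ≡ S → (X +ᶻ R) +ᶻ Z ≡ Y +ᶻ S
  combine X Z Y C R L S h₁ refl =
    trans (rearrange X Z C R L) (cong (_+ᶻ ((C +ᶻ R) -ᶻ L)) (sym (trans (cancel Y C) (cong (_-ᶻ C) h₁))))

φ-occurrence : ∀ q → OccursAt q w → IsTPrefix (φ (prefix q) ++ φ w)
φ-occurrence q h = subst IsTPrefix (φ-++ (prefix q) _) (IsTPrefix-φ h)

occurs-inside : ∀ u L s k → IsTPrefix (u ++ L) → s ≤ length L → OccursAt (length u + s) (take k (drop s L))
occurs-inside u L s k h hs = subst (λ y → IsTPrefix (y ++ take k (drop s L))) (sym (prefix-++ u L s h hs))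
  (IsTPrefix-⊑ (subst (λ y → y ⊑ u ++ L) (sym (++-assoc u (take s L) _))
     (++⁺-⊑ u (subst (take s L ++ take k (drop s L) ⊑_) (take++drop≡id s L)
       (++⁺-⊑ (take s L) (take-⊑ k (drop s L)))))) h)

-- A state (a , v , w): the first letter a of a factor of t, its relative
-- Parikh vector v, and a window w of t starting at the factor's last letter.
State : Set
State = Letter × Vec3 × List Letter

letterOf : State → Letter
letterOf = proj₁

relOf : State → Vec3
relOf σ = proj₁ (proj₂ σ)

windowOf : State → List Letter
windowOf σ = proj₂ (proj₂ σ)

-- σ describes the factor t[q,q+m) of t (m ≥ 1); the Parikh condition says
-- that relOf σ is the relative Parikh vector of that factor.
record Describes (q m : ℕ) (σ : State) : Set where
  constructor describes
  field
    nonempty : 1 ≤ m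
    first    : OccursAt q (letterOf σ ∷ [])
    window   : OccursAt (q + pred m) (windowOf σ)
    parikh   : Ψ (prefix (q + m)) ≡ (Ψ (prefix q) +₃ Ψ (prefix m)) +₃ relOf σ

+-pred : ∀ q {m} → 1 ≤ m → q + pred m + 1 ≡ q + m
+-pred q {suc m} _ = trans (+-assoc q m 1) (cong (_+_ q) (+-comm m 1))

last-letter : ∀ {q m a v c ew} → Describes q m (a , v , c ∷ ew) →
  prefix (q + m) ≡ prefix (q + pred m) ++ c ∷ []
last-letter {q} {m} {c = c} {ew} d =
  IsTPrefix⇒prefix _ (IsTPrefix-⊑ (++⁺-⊑ (prefix (q + pred m)) (ew , refl)) (Describes.window d))
    (trans (length-++ (prefix (q + pred m))) (trans (cong (_+ 1) (length-prefix _)) (+-pred q (Describes.nonempty d))))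

last-letter-Ψ : ∀ {q m a v c ew} → Describes q m (a , v , c ∷ ew) →
  Ψ (prefix (q + pred m)) +₃ e c ≡ (Ψ (prefix q) +₃ Ψ (prefix m)) +₃ v
last-letter-Ψ {q} {m} {c = c} d =
  trans (sym (Ψ-++ (prefix (q + pred m)) (c ∷ []))) (trans (cong Ψ (sym (last-letter d))) (Describes.parikh d))

-- Apply φ to a factor with state (a , v , c ∷ ew)
-- and start reading at offset r inside the block φ(a).  The image factor
-- of length |φ(t[0,m))| then ends s + 1 letters into φ(c ∷ ew), where
-- s + 1 = |φ(c)| + r − ℓ₃(v) by 'step-length'; the step is defined only
-- when these positions exist.
windowLength : ℕ
windowLength = 5

stepFrom : Letter → Vec3 → Letter → List Letter → ℕ → List Letter → ℤ → Maybe State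
stepFrom a v c ew r (a' ∷ _) (+ suc s) with suc s ≤? length (φ (c ∷ ew))
... | yes _ = just (a' , (A₃ (v -₃ e c) -₃ Ψ (take r (φ₁ a))) +₃ Ψ (take (suc s) (φ (c ∷ ew))) ,
                    take windowLength (drop s (φ (c ∷ ew))))
... | no _  = nothing
stepFrom _ _ _ _ _ _ _ = nothing

step : State → ℕ → Maybe State
step (a , v , [])     r = nothing
step (a , v , c ∷ ew) r = stepFrom a v c ew r (drop r (φ₁ a)) ((+ (length (φ₁ c) + r)) -ᶻ ℓ₃ v)

drop-nonempty : ∀ r (y : List Letter) {a z} → drop r y ≡ a ∷ z → r < length y
drop-nonempty zero    (_ ∷ _) _  = s≤s z≤n
drop-nonempty (suc r) (_ ∷ y) eq = s≤s (drop-nonempty r y eq)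

φ-letter-occurrence : ∀ q {a} → OccursAt q (a ∷ []) → IsTPrefix (φ (prefix q) ++ φ₁ a)
φ-letter-occurrence q {a} h = subst (λ y → IsTPrefix (φ (prefix q) ++ y)) (++-identityʳ (φ₁ a)) (φ-occurrence q h)

Ψ-prefix-φ : ∀ X W j → IsTPrefix (φ X ++ W) → j ≤ length W →
  Ψ (prefix (length (φ X) + j)) ≡ A₃ (Ψ X) +₃ Ψ (take j W)
Ψ-prefix-φ X W j h hj =
  trans (cong Ψ (prefix-++ (φ X) W j h hj)) (trans (Ψ-++ (φ X) (take j W)) (cong (_+₃ Ψ (take j W)) (Ψ-φ X)))

step-describes : ∀ q m a v c ew r a' rest s → Describes q m (a , v , c ∷ ew) →
  drop r (φ₁ a) ≡ a' ∷ rest → (+ (length (φ₁ c) + r)) -ᶻ ℓ₃ v ≡ + suc s → suc s ≤ length (φ (c ∷ ew)) →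
  Describes (length (φ (prefix q)) + r) (length (φ (prefix m)))
    (a' , (A₃ (v -₃ e c) -₃ Ψ (take r (φ₁ a))) +₃ Ψ (take (suc s) (φ (c ∷ ew))) ,
          take windowLength (drop s (φ (c ∷ ew))))
step-describes q m a v c ew r a' rest s d hd hs hl = describes nonempty′ first′ window′ parikh′
  where
  X Y Z L : List Letter
  X = prefix q
  Y = prefix (q + pred m)
  Z = prefix m
  L = φ (c ∷ ew)
  P S : Vec3
  P = Ψ (take r (φ₁ a))
  S = Ψ (take (suc s) L)
  hX : IsTPrefix (φ X ++ φ₁ a)
  hX = φ-letter-occurrence q (Describes.first d)
  hY : IsTPrefix (φ Y ++ L)
  hY = φ-occurrence (q + pred m) (Describes.window d)
  end : (length (φ X) + r) + length (φ Z) ≡ length (φ Y) + suc s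
  end = step-length X Y Z c v r s (last-letter-Ψ d) hs
  nonempty′ : 1 ≤ length (φ Z)
  nonempty′ = ≤-trans (Describes.nonempty d) (subst (_≤ length (φ Z)) (length-prefix m) (length-φ Z))
  first′ : OccursAt (length (φ X) + r) (a' ∷ [])
  first′ = subst (λ y → OccursAt _ (take 1 y)) hd
             (occurs-inside (φ X) (φ₁ a) r 1 hX (<⇒≤ (drop-nonempty r (φ₁ a) hd)))
  window′ : OccursAt ((length (φ X) + r) + pred (length (φ Z))) (take windowLength (drop s L))
  window′ = subst (λ i → OccursAt i (take windowLength (drop s L)))
              (sym (+-cancelʳ-≡ 1 _ _ (trans (+-pred (length (φ X) + r) nonempty′)
                (trans end (sym (+-pred (length (φ Y)) {suc s} (s≤s z≤n)))))))
              (occurs-inside (φ Y) L s windowLength hY (<⇒≤ hl))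
  parikh′ : Ψ (prefix ((length (φ X) + r) + length (φ Z)))
            ≡ (Ψ (prefix (length (φ X) + r)) +₃ Ψ (prefix (length (φ Z)))) +₃ ((A₃ (v -₃ e c) -₃ P) +₃ S)
  parikh′ = begin
    Ψ (prefix ((length (φ X) + r) + length (φ Z)))  ≡⟨ cong (λ i → Ψ (prefix i)) end ⟩
    Ψ (prefix (length (φ Y) + suc s))               ≡⟨ Ψ-prefix-φ Y L (suc s) hY hl ⟩
    A₃ (Ψ Y) +₃ S                                   ≡⟨ step-identity (Ψ Y) (e c) (Ψ X) (Ψ Z) v P S (last-letter-Ψ d) ⟩
    ((A₃ (Ψ X) +₃ P) +₃ A₃ (Ψ Z)) +₃ ((A₃ (v -₃ e c) -₃ P) +₃ S)
      ≡⟨ cong (λ t → t +₃ ((A₃ (v -₃ e c) -₃ P) +₃ S)) (sym (cong₂ _+₃_ start length′)) ⟩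
    (Ψ (prefix (length (φ X) + r)) +₃ Ψ (prefix (length (φ Z)))) +₃ ((A₃ (v -₃ e c) -₃ P) +₃ S) ∎
    where
    open ≡-Reasoning
    start : Ψ (prefix (length (φ X) + r)) ≡ A₃ (Ψ X) +₃ P
    start = Ψ-prefix-φ X (φ₁ a) r hX (<⇒≤ (drop-nonempty r (φ₁ a) hd))
    length′ : Ψ (prefix (length (φ Z))) ≡ A₃ (Ψ Z)
    length′ = trans (cong Ψ (IsTPrefix-φ (prefix-IsTPrefix m))) (Ψ-φ Z)

step-sound : ∀ q m σ r {σ'} → Describes q m σ → step σ r ≡ just σ' →
  Describes (length (φ (prefix q)) + r) (length (φ (prefix m))) σ'
step-sound q m (a , v , c ∷ ew) r d eq with drop r (φ₁ a) in hd | (+ (length (φ₁ c) + r)) -ᶻ ℓ₃ v in hs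
... | a' ∷ rest | + suc s with suc s ≤? length (φ (c ∷ ew))
...   | yes hl with eq
...     | refl = step-describes q m a v c ew r a' rest s d hd hs hl

-- Lengthening a factor by one letter, the second letter d of its window.
-- This is sound when t_m = 0, since then t[0,m+1) = t[0,m) 0.
extend : State → Maybe State
extend (a , v , c ∷ d ∷ ew) = just (a , (v +₃ e d) -₃ e zero , d ∷ ew)
extend _                    = nothing

extend-identity : ∀ x z v d f → ((x +₃ z) +₃ v) +₃ d ≡ (x +₃ (z +₃ f)) +₃ ((v +₃ d) -₃ f)
extend-identity (x₀ , x₁ , x₂) (z₀ , z₁ , z₂) (v₀ , v₁ , v₂) (d₀ , d₁ , d₂) (f₀ , f₁ , f₂) =
  cong₃ (identity x₀ z₀ v₀ d₀ f₀) (identity x₁ z₁ v₁ d₁ f₁) (identity x₂ z₂ v₂ d₂ f₂)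
  where
  identity : ∀ x z v d f → ((x +ᶻ z) +ᶻ v) +ᶻ d ≡ (x +ᶻ (z +ᶻ f)) +ᶻ ((v +ᶻ d) -ᶻ f)
  identity = solve-∀

prefix-suc : ∀ n {a w} → OccursAt n (a ∷ w) → prefix (suc n) ≡ prefix n ++ a ∷ []
prefix-suc n h = trans (cong prefix (trans (+-comm 1 n) (cong (_+ 1) (sym (length-prefix n)))))
                       (prefix-++ (prefix n) _ 1 h (s≤s z≤n))

extend-sound : ∀ q m σ {σ'} → Describes q m σ → OccursAt m (zero ∷ []) → extend σ ≡ just σ' →
  Describes q (suc m) σ'
extend-sound q m (a , v , c ∷ d ∷ ew) dσ h₀ refl =
  describes (s≤s z≤n) (Describes.first dσ) window′ parikh′
  where
  window′ : OccursAt (q + m) (d ∷ ew)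
  window′ = subst (λ y → IsTPrefix (y ++ d ∷ ew)) (sym (last-letter dσ))
              (subst IsTPrefix (sym (++-assoc (prefix (q + pred m)) (c ∷ []) (d ∷ ew))) (Describes.window dσ))
  parikh′ : Ψ (prefix (q + suc m)) ≡ (Ψ (prefix q) +₃ Ψ (prefix (suc m))) +₃ ((v +₃ e d) -₃ e zero)
  parikh′ = begin
    Ψ (prefix (q + suc m))                              ≡⟨ cong (λ i → Ψ (prefix i)) (+-suc q m) ⟩
    Ψ (prefix (suc (q + m)))                            ≡⟨ cong Ψ (prefix-suc (q + m) window′) ⟩
    Ψ (prefix (q + m) ++ d ∷ [])                        ≡⟨ Ψ-++ (prefix (q + m)) (d ∷ []) ⟩
    Ψ (prefix (q + m)) +₃ e d                           ≡⟨ cong (_+₃ e d) (Describes.parikh dσ) ⟩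
    ((Ψ (prefix q) +₃ Ψ (prefix m)) +₃ v) +₃ e d         ≡⟨ extend-identity (Ψ (prefix q)) (Ψ (prefix m)) v (e d) (e zero) ⟩
    (Ψ (prefix q) +₃ (Ψ (prefix m) +₃ e zero)) +₃ ((v +₃ e d) -₃ e zero)
      ≡⟨ cong (λ t → (Ψ (prefix q) +₃ t) +₃ ((v +₃ e d) -₃ e zero))
              (sym (trans (cong Ψ (prefix-suc m h₀)) (Ψ-++ (prefix m) (zero ∷ [])))) ⟩
    (Ψ (prefix q) +₃ Ψ (prefix (suc m))) +₃ ((v +₃ e d) -₃ e zero) ∎
    where open ≡-Reasoning

record Preimage (p : ℕ) : Set where
  constructor preimage
  field
    origin   : ℕ
    letter   : Letter
    offset   : ℕ
    occurs   : OccursAt origin (letter ∷ [])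
    inside   : offset < length (φ₁ letter)
    position : p ≡ length (φ (prefix origin)) + offset

φ₁-nonempty : ∀ a → 0 < length (φ₁ a)
φ₁-nonempty zero             = s≤s z≤n
φ₁-nonempty (suc zero)       = s≤s z≤n
φ₁-nonempty (suc (suc zero)) = s≤s z≤n

decompose : ∀ p → Preimage p
decompose zero = preimage 0 zero 0 refl (s≤s z≤n) refl
decompose (suc p) with decompose p
... | preimage q a r h r<φa eq with suc r <? length (φ₁ a)
...   | yes r+1<φa = preimage q a (suc r) h r+1<φa (trans (cong suc eq) (sym (+-suc _ r)))
...   | no r+1≮φa  = preimage (suc q) b 0 hb (φ₁-nonempty b) next-block
  where
  b : Letter
  b = proj₁ (IsTPrefix-extend (prefix-IsTPrefix (suc q)))
  hb : OccursAt (suc q) (b ∷ [])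
  hb = proj₂ (IsTPrefix-extend (prefix-IsTPrefix (suc q)))
  block-end : suc r ≡ length (φ₁ a)
  block-end = ≤-antisym r<φa (≤-pred (≰⇒> r+1≮φa))
  next-block : suc p ≡ length (φ (prefix (suc q))) + 0
  next-block = begin
    suc p                                   ≡⟨ cong suc eq ⟩
    suc (length (φ (prefix q)) + r)         ≡⟨ sym (+-suc _ r) ⟩
    length (φ (prefix q)) + suc r           ≡⟨ cong (_+_ (length (φ (prefix q)))) block-end ⟩
    length (φ (prefix q)) + length (φ₁ a)   ≡⟨ sym (length-++ (φ (prefix q))) ⟩
    length (φ (prefix q) ++ φ₁ a)           ≡⟨ cong length (sym (φ-snoc (prefix q) a)) ⟩
    length (φ (prefix q ++ a ∷ []))         ≡⟨ cong (λ y → length (φ y)) (sym (prefix-suc q h)) ⟩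
    length (φ (prefix (suc q)))             ≡⟨ sym (+-identityʳ _) ⟩
    length (φ (prefix (suc q))) + 0         ∎
    where open ≡-Reasoning

Covers : List State → ℕ → Set
Covers S m = ∀ q → ∃[ σ ] (σ ∈ S × Describes q m σ)

StepsInto : List State → State → Set
StepsInto S' σ = ∀ (r : Fin (length (φ₁ (letterOf σ)))) → Lands (_∈ S') (step σ (toℕ r))

lands-just : ∀ {S' : List State} {m : Maybe State} → Lands (_∈ S') m → ∃[ σ ] (m ≡ just σ × σ ∈ S')
lands-just (just σ∈S') = _ , refl , σ∈S'

-- If S covers length m and every step from S lands in S', then S' covers
-- the length of the image φ(t[0,m)): each position has a preimage, and
-- the state there steps to a state of S' describing the image factor.
cover-step : ∀ {S S' m u} → All (StepsInto S') S → prefix m ≡ u → Covers S m → Covers S' (length (φ u))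
cover-step {S' = S'} {m} closed refl cover p with decompose p
... | preimage q a r ha r<φa refl with cover q
...   | σ@(b , _ , _) , σ∈S , dσ with IsTPrefix-letter-unique (prefix q) (Describes.first dσ) ha
...     | refl with lands-just (subst (λ i → Lands (_∈ S') (step σ i)) (toℕ-fromℕ< r<φa)
                                  (All-lookup closed σ∈S (fromℕ< r<φa)))
...       | σ' , stepped , σ'∈S' = σ' , σ'∈S' , step-sound q m σ r dσ stepped

cover-extend : ∀ {S S' m} → All (λ σ → Lands (_∈ S') (extend σ)) S → OccursAt m (zero ∷ []) →
  Covers S m → Covers S' (suc m)
cover-extend closed h₀ cover q with cover q
... | σ , σ∈S , dσ with lands-just (All-lookup closed σ∈S)
...   | σ' , extended , σ'∈S' = σ' , σ'∈S' , extend-sound q _ σ dσ h₀ extended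

-- Every nonempty prefix of t starts with 0, so φ strictly lengthens it.
φ-prefix-grows : ∀ q → suc (suc q) ≤ length (φ (prefix (suc q)))
φ-prefix-grows q with φ^-head (suc q)
... | y , eq = subst (λ z → suc (suc q) ≤ length (φ z)) (sym starts-with-0)
                (s≤s (s≤s (≤-trans (≤-reflexive (sym length-rest)) (length-φ (take q y)))))
  where
  starts-with-0 : prefix (suc q) ≡ zero ∷ take q y
  starts-with-0 = cong (take (suc q)) eq
  length-rest : length (take q y) ≡ q
  length-rest = suc-injective (trans (cong length (sym starts-with-0)) (length-prefix (suc q)))

origin< : ∀ q r p → suc p ≡ length (φ (prefix q)) + r → q < suc p
origin< zero    r p _  = s≤s z≤n
origin< (suc q) r p eq =
  ≤-trans (φ-prefix-grows q) (subst (length (φ (prefix (suc q))) ≤_) (sym eq) (m≤m+n _ r))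

ImagesIn : ℕ → List (List Letter) → List Letter → Set
ImagesIn k F []      = ⊥
ImagesIn k F (a ∷ w) = ∀ (r : Fin (length (φ₁ a))) → take k (drop (toℕ r) (φ (a ∷ w))) ∈ F

-- If t starts with a word of such a list F, then every position of t does:
-- by strong induction, the word at the preimage of a position yields one
-- at the position itself.
windows : ∀ k F → All (ImagesIn k F) F → ∃[ w ] (w ∈ F × OccursAt 0 w) → ∀ p → ∃[ w ] (w ∈ F × OccursAt p w)
windows k F closed start = <-rec (λ p → ∃[ w ] (w ∈ F × OccursAt p w)) go
  where
  go : ∀ p → (∀ {q} → q < p → ∃[ w ] (w ∈ F × OccursAt q w)) → ∃[ w ] (w ∈ F × OccursAt p w)
  go zero    _  = start
  go (suc p) ih with decompose (suc p)
  ... | preimage q a r ha r<φa eq with ih (origin< q r p eq)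
  ...   | [] , []∈F , _ = ⊥-elim (All-lookup closed []∈F)
  ...   | b ∷ w , w∈F , hw with IsTPrefix-letter-unique (prefix q) (occurs-⊑ q (w , refl) hw) ha
  ...     | refl = take k (drop r (φ (a ∷ w))) , image∈F ,
                   subst (λ i → OccursAt i (take k (drop r (φ (a ∷ w))))) (sym eq) image-occurs
    where
    image∈F : take k (drop r (φ (a ∷ w))) ∈ F
    image∈F = subst (λ i → take k (drop i (φ (a ∷ w))) ∈ F) (toℕ-fromℕ< r<φa)
                (All-lookup closed w∈F (fromℕ< r<φa))
    image-occurs : OccursAt (length (φ (prefix q)) + r) (take k (drop r (φ (a ∷ w))))
    image-occurs = occurs-inside (φ (prefix q)) (φ (a ∷ w)) r k (φ-occurrence q hw)
                     (≤-trans (<⇒≤ r<φa) (subst (length (φ₁ a) ≤_) (sym (length-++ (φ₁ a))) (m≤m+n _ _)))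

φ* : ℕ → List Letter → List Letter
φ* zero    u = u
φ* (suc k) u = φ (φ* k u)

φ*-++ : ∀ k u v → φ* k (u ++ v) ≡ φ* k u ++ φ* k v
φ*-++ zero    u v = refl
φ*-++ (suc k) u v = trans (cong φ (φ*-++ k u v)) (φ-++ (φ* k u) (φ* k v))

φ*-+ : ∀ a b u → φ* (a + b) u ≡ φ* a (φ* b u)
φ*-+ zero    b u = refl
φ*-+ (suc a) b u = cong φ (φ*-+ a b u)

φ*-φ : ∀ k u → φ* k (φ u) ≡ φ* (suc k) u
φ*-φ k u = trans (sym (φ*-+ k 1 u)) (cong (λ j → φ* j u) (+-comm k 1))

φ^-φ* : ∀ k → φ^ k [0] ≡ φ* k (zero ∷ [])
φ^-φ* zero    = refl
φ^-φ* (suc k) = cong φ (φ^-φ* k)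

IsTPrefix-φ* : ∀ k → IsTPrefix u → IsTPrefix (φ* k u)
IsTPrefix-φ* zero    h = h
IsTPrefix-φ* (suc k) h = IsTPrefix-φ (IsTPrefix-φ* k h)

-- The prefix t[0,M_i): t[0,M_{i+1}) = φ⁴(t[0,M_i) 0), which unfolds to
-- φ^{4(i+1)}(0) φ^{4i}(0) ⋯ φ⁴(0), of length F_{4(i+1)} + ⋯ + F_4 = M_{i+1}.
Mword : ℕ → List Letter
Mword zero    = []
Mword (suc i) = φ* 4 (Mword i ++ zero ∷ [])

Mword-blocks : ∀ i → Mword (suc i) ≡ φ* (4 * suc i) (zero ∷ []) ++ Mword i
Mword-blocks zero    = sym (++-identityʳ _)
Mword-blocks (suc i) = begin
  φ* 4 (Mword (suc i) ++ zero ∷ [])                ≡⟨ cong (λ y → φ* 4 (y ++ zero ∷ [])) (Mword-blocks i) ⟩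
  φ* 4 ((B ++ Mword i) ++ zero ∷ [])               ≡⟨ cong (φ* 4) (++-assoc B (Mword i) (zero ∷ [])) ⟩
  φ* 4 (B ++ (Mword i ++ zero ∷ []))               ≡⟨ φ*-++ 4 B _ ⟩
  φ* 4 B ++ Mword (suc i)                          ≡⟨ cong (_++ Mword (suc i)) (sym (φ*-+ 4 (4 * suc i) (zero ∷ []))) ⟩
  φ* (4 + 4 * suc i) (zero ∷ []) ++ Mword (suc i)  ≡⟨ cong (λ k → φ* k (zero ∷ []) ++ Mword (suc i)) (sym (*-suc 4 (suc i))) ⟩
  φ* (4 * suc (suc i)) (zero ∷ []) ++ Mword (suc i) ∎
  where
  open ≡-Reasoning
  B : List Letter
  B = φ* (4 * suc i) (zero ∷ [])

length-Mword : ∀ i → length (Mword i) ≡ M i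
length-Mword zero    = refl
length-Mword (suc i) = begin
  length (Mword (suc i))                                       ≡⟨ cong length (Mword-blocks i) ⟩
  length (φ* (4 * suc i) (zero ∷ []) ++ Mword i)               ≡⟨ length-++ (φ* (4 * suc i) (zero ∷ [])) ⟩
  length (φ* (4 * suc i) (zero ∷ [])) + length (Mword i)       ≡⟨ cong₂ _+_ (cong length (sym (φ^-φ* (4 * suc i)))) (length-Mword i) ⟩
  F (4 * suc i) + M i                                          ≡⟨ +-comm (F (4 * suc i)) (M i) ⟩
  M (suc i)                                                    ∎
  where open ≡-Reasoning

M-grows : ∀ i → i ≤ M i
M-grows zero    = z≤n
M-grows (suc i) = subst (suc i ≤_) (+-comm (F (4 * suc i)) (M i))
  (+-mono-≤ (≤-trans (s≤s z≤n) (F-grows (4 * suc i))) (M-grows i))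

-- Every block φ(b) starts with 0, so an image φ(v) of a prefix of t is followed by 0.
φ-followed-by-0 : IsTPrefix v → IsTPrefix (φ v ++ zero ∷ [])
φ-followed-by-0 {v} h with IsTPrefix-extend h
... | b , hb = IsTPrefix-⊑ (++⁺-⊑ (φ v) (starts-with-0 b)) (subst IsTPrefix (φ-snoc v b) (IsTPrefix-φ hb))
  where
  starts-with-0 : ∀ b → zero ∷ [] ⊑ φ₁ b
  starts-with-0 zero             = _ , refl
  starts-with-0 (suc zero)       = _ , refl
  starts-with-0 (suc (suc zero)) = _ , refl

Mword-0 : ∀ i → IsTPrefix (Mword i ++ zero ∷ [])
Mword-0 zero    = refl
Mword-0 (suc i) = φ-followed-by-0 (IsTPrefix-φ* 3 (Mword-0 i))

prefix-M : ∀ i → prefix (M i) ≡ Mword i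
prefix-M i = IsTPrefix⇒prefix _ (IsTPrefix-⊑ (_ , refl) (Mword-0 i)) (length-Mword i)

occurs-0-at-M : ∀ i → OccursAt (M i) (zero ∷ [])
occurs-0-at-M i = subst (λ y → IsTPrefix (y ++ zero ∷ [])) (sym (prefix-M i)) (Mword-0 i)

prefix-suc-M : ∀ i → prefix (suc (M i)) ≡ Mword i ++ zero ∷ []
prefix-suc-M i = trans (prefix-suc (M i) (occurs-0-at-M i)) (cong (_++ zero ∷ []) (prefix-M i))

run : ∀ {k} → State → Vec ℕ k → Maybe State
run σ []       = just σ
run σ (r ∷ rs) = step σ r >>= λ σ₁ → run σ₁ rs

run-sound : ∀ {k} (rs : Vec ℕ k) q m u {σ σ'} → prefix m ≡ u → Describes q m σ → run σ rs ≡ just σ' →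
  ∃[ q' ] Describes q' (length (φ* k u)) σ'
run-sound []       q m u refl dσ refl = q , subst (λ n → Describes q n _) (sym (length-prefix m)) dσ
run-sound {suc k} (r ∷ rs) q m u {σ} refl dσ ran with step σ r in stepped
... | just σ₁ with run-sound rs _ (length (φ u)) (φ u) (IsTPrefix-φ (prefix-IsTPrefix m))
                     (step-sound q m σ r dσ stepped) ran
...   | q' , dσ' = q' , subst (λ n → Describes q' n _) (cong length (φ*-φ k u)) dσ'

-- One round: extend by the letter t_{M_i} = 0, then four steps, which
-- passes from length M_i to length |φ⁴(t[0,M_i) 0)| = M_{i+1}.
round : State → Vec ℕ 4 → Maybe State
round σ rs = extend σ >>= λ σ₁ → run σ₁ rs

run-from-M : ∀ i (rs : Vec ℕ 4) q {σ σ'} → Describes q (suc (M i)) σ → run σ rs ≡ just σ' → ∃[ q' ] Describes q' (M (suc i)) σ'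
run-from-M i rs q dσ ran with run-sound rs q (suc (M i)) _ (prefix-suc-M i) dσ ran
... | q' , dσ' = q' , subst (λ n → Describes q' n _) (length-Mword (suc i)) dσ'

round-sound : ∀ i (rs : Vec ℕ 4) q {σ σ'} → Describes q (M i) σ → round σ rs ≡ just σ' → ∃[ q' ] Describes q' (M (suc i)) σ'
round-sound i rs q {σ} dσ ran with extend σ in extended
... | just σ₁ = run-from-M i rs q (extend-sound q (M i) σ dσ (occurs-0-at-M i) extended) ran

initial : Letter → List Letter → State
initial a w = (a , e a -₃ e zero , a ∷ w)

initial-describes : ∀ q a w → OccursAt q (a ∷ w) → Describes q 1 (initial a w)
initial-describes q a w h =
  describes (s≤s z≤n) (occurs-⊑ q (w , refl) h) (subst (λ i → OccursAt i (a ∷ w)) (sym (+-identityʳ q)) h) parikh′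
  where
  open ≡-Reasoning
  x₀ : Vec3
  x₀ = Ψ (prefix q)
  parikh′ : Ψ (prefix (q + 1)) ≡ (x₀ +₃ e zero) +₃ (e a -₃ e zero)
  parikh′ = begin
    Ψ (prefix (q + 1))                  ≡⟨ cong (λ i → Ψ (prefix i)) (+-comm q 1) ⟩
    Ψ (prefix (suc q))                  ≡⟨ trans (cong Ψ (prefix-suc q h)) (Ψ-++ (prefix q) (a ∷ [])) ⟩
    x₀ +₃ e a                            ≡⟨ cong (x₀ +₃_) (add-sub (e zero) (e a)) ⟩
    x₀ +₃ (e zero +₃ (e a -₃ e zero))    ≡⟨ sym (+₃-assoc x₀ (e zero) (e a -₃ e zero)) ⟩
    (x₀ +₃ e zero) +₃ (e a -₃ e zero)    ∎

InitialIn : List State → List Letter → Set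
InitialIn S []      = ⊥
InitialIn S (a ∷ w) = initial a w ∈ S

cover-initial : ∀ {F S} → (∀ p → ∃[ w ] (w ∈ F × OccursAt p w)) → All (InitialIn S) F → Covers S 1
cover-initial starts inS q with starts q
... | []    , []∈F , _ = ⊥-elim (All-lookup inS []∈F)
... | a ∷ w , w∈F  , h = initial a w , All-lookup inS w∈F , initial-describes q a w h

relative-vector : ∀ q n σ → Describes q n σ → Ψrel (factorAt q n) ≡ relOf σ
relative-vector q n σ d = begin
  Ψ f -₃ Ψ (prefix (length f))      ≡⟨ cong (λ k → Ψ f -₃ Ψ (prefix k)) (length-factorAt q n) ⟩
  Ψ f -₃ Ψ (prefix n)               ≡⟨ sym (+₃-cancelˡ (Ψ (prefix n)) _ _ (trans factor-parikh (add-sub (Ψ (prefix n)) (Ψ f)))) ⟩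
  relOf σ                           ∎
  where
  open ≡-Reasoning
  f : List Letter
  f = factorAt q n
  factor-parikh : Ψ (prefix n) +₃ relOf σ ≡ Ψ f
  factor-parikh = sym (+₃-cancelˡ (Ψ (prefix q)) _ _ (begin
    Ψ (prefix q) +₃ Ψ f                           ≡⟨ sym (Ψ-++ (prefix q) f) ⟩
    Ψ (prefix q ++ f)                             ≡⟨ cong Ψ (sym (prefix-split q n)) ⟩
    Ψ (prefix (q + n))                            ≡⟨ Describes.parikh d ⟩
    (Ψ (prefix q) +₃ Ψ (prefix n)) +₃ relOf σ     ≡⟨ +₃-assoc (Ψ (prefix q)) (Ψ (prefix n)) (relOf σ) ⟩
    Ψ (prefix q) +₃ (Ψ (prefix n) +₃ relOf σ)     ∎))

-- If the relative Parikh vectors of length n form a duplicate-free list L,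
-- then AC(n) = |L|: translating by Ψ(t[0,n)) is a bijection onto the Parikh vectors.
abelian-complexity : ∀ n (L : List Vec3) → Unique L → (∀ v → InPrel n v ⇔ (v ∈ L)) → AC≡ n (length L)
abelian-complexity n L unique rel =
  map (base +₃_) L , Unique.map⁺ (+₃-cancelˡ base _ _) unique , length-map (base +₃_) L ,
  λ v → mk⇔ (to v) (from v)
  where
  base : Vec3
  base = Ψ (prefix n)
  decompose-Ψ : ∀ q → Ψ (factorAt q n) ≡ base +₃ Ψrel (factorAt q n)
  decompose-Ψ q = subst (λ k → Ψ (factorAt q n) ≡ Ψ (prefix k) +₃ Ψrel (factorAt q n)) (length-factorAt q n)
                    (add-sub (Ψ (prefix (length (factorAt q n)))) (Ψ (factorAt q n)))
  to : ∀ v → v ∈ map (base +₃_) L → InParikhSet n v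
  to v v∈ with ∈-map⁻ (base +₃_) v∈
  ... | u , u∈L , refl with Equivalence.from (rel u) u∈L
  ...   | w , (q , refl) , refl = factorAt q n , (q , refl) , decompose-Ψ q
  from : ∀ v → InParikhSet n v → v ∈ map (base +₃_) L
  from v (w , (q , refl) , refl) = subst (_∈ map (base +₃_) L) (sym (decompose-Ψ q))
    (∈-map⁺ (base +₃_) (Equivalence.to (rel (Ψrel (factorAt q n))) (factorAt q n , (q , refl) , refl)))

_≟ᵛ_ : DecidableEquality Vec3
_≟ᵛ_ = ≡-dec-× _≟ᶻ_ (≡-dec-× _≟ᶻ_ _≟ᶻ_)

_≟ˢ_ : DecidableEquality State
_≟ˢ_ = ≡-dec-× _≟ˡ_ (≡-dec-× _≟ᵛ_ (≡-dec-List _≟ˡ_))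

_∈ˢ?_ : ∀ σ (S : List State) → Dec (σ ∈ S)
σ ∈ˢ? S = DecMembership._∈?_ _≟ˢ_ σ S

_∈ʷ?_ : ∀ w (F : List (List Letter)) → Dec (w ∈ F)
w ∈ʷ? F = DecMembership._∈?_ (≡-dec-List _≟ˡ_) w F

steps-into? : ∀ S' σ → Dec (StepsInto S' σ)
steps-into? S' σ = all-Fin? (λ r → Lands.dec (_∈ˢ? S') (step σ (toℕ r)))

extends-into? : ∀ S' σ → Dec (Lands (_∈ S') (extend σ))
extends-into? S' σ = Lands.dec (_∈ˢ? S') (extend σ)

images-in? : ∀ k F w → Dec (ImagesIn k F w)
images-in? k F []      = no λ ()
images-in? k F (a ∷ w) = all-Fin? (λ r → take k (drop (toℕ r) (φ (a ∷ w))) ∈ʷ? F)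

initial-in? : ∀ S w → Dec (InitialIn S w)
initial-in? S []      = no λ ()
initial-in? S (a ∷ w) = initial a w ∈ˢ? S

-- The data of the proof: the length-4 factors of t, and the five lists of
-- states covering lengths M_i + 1 (P0) and, after one to four φ-steps,
-- lengths |φ(t[0,M_i + 1))| (P1), ..., M_{i+1} (PR).
l0 l1 l2 : Letter
l0 = zero
l1 = suc zero
l2 = suc (suc zero)

factors4 : List (List Letter)
factors4 =
  (l0 ∷ l0 ∷ l1 ∷ l0 ∷ []) ∷
  (l0 ∷ l1 ∷ l0 ∷ l0 ∷ []) ∷
  (l0 ∷ l1 ∷ l0 ∷ l1 ∷ []) ∷
  (l0 ∷ l1 ∷ l0 ∷ l2 ∷ []) ∷
  (l0 ∷ l2 ∷ l0 ∷ l1 ∷ []) ∷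
  (l1 ∷ l0 ∷ l0 ∷ l1 ∷ []) ∷
  (l1 ∷ l0 ∷ l1 ∷ l0 ∷ []) ∷
  (l1 ∷ l0 ∷ l2 ∷ l0 ∷ []) ∷
  (l2 ∷ l0 ∷ l1 ∷ l0 ∷ []) ∷
  []

P0 : List State
P0 =
  (l0 , (-[1+ 0 ] , + 0 , + 1) , l1 ∷ l0 ∷ l0 ∷ l1 ∷ []) ∷
  (l0 , (-[1+ 0 ] , + 0 , + 1) , l2 ∷ l0 ∷ l1 ∷ l0 ∷ []) ∷
  (l0 , (+ 0 , -[1+ 0 ] , + 1) , l0 ∷ l1 ∷ l0 ∷ l0 ∷ []) ∷
  (l0 , (+ 0 , -[1+ 0 ] , + 1) , l0 ∷ l1 ∷ l0 ∷ l1 ∷ []) ∷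
  (l0 , (+ 0 , + 0 , + 0) , l0 ∷ l0 ∷ l1 ∷ l0 ∷ []) ∷
  (l0 , (+ 0 , + 0 , + 0) , l0 ∷ l1 ∷ l0 ∷ l0 ∷ []) ∷
  (l0 , (+ 0 , + 0 , + 0) , l0 ∷ l1 ∷ l0 ∷ l1 ∷ []) ∷
  (l0 , (+ 0 , + 0 , + 0) , l0 ∷ l1 ∷ l0 ∷ l2 ∷ []) ∷
  (l0 , (+ 0 , + 0 , + 0) , l0 ∷ l2 ∷ l0 ∷ l1 ∷ []) ∷
  (l0 , (+ 0 , + 0 , + 0) , l1 ∷ l0 ∷ l1 ∷ l0 ∷ []) ∷
  (l0 , (+ 0 , + 0 , + 0) , l1 ∷ l0 ∷ l2 ∷ l0 ∷ []) ∷
  (l0 , (+ 0 , + 0 , + 0) , l2 ∷ l0 ∷ l1 ∷ l0 ∷ []) ∷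
  (l0 , (+ 0 , + 1 , -[1+ 0 ]) , l1 ∷ l0 ∷ l2 ∷ l0 ∷ []) ∷
  (l1 , (-[1+ 0 ] , + 0 , + 1) , l0 ∷ l1 ∷ l0 ∷ l0 ∷ []) ∷
  (l1 , (-[1+ 0 ] , + 0 , + 1) , l2 ∷ l0 ∷ l1 ∷ l0 ∷ []) ∷
  (l1 , (-[1+ 0 ] , + 1 , + 0) , l1 ∷ l0 ∷ l0 ∷ l1 ∷ []) ∷
  (l1 , (-[1+ 0 ] , + 1 , + 0) , l1 ∷ l0 ∷ l1 ∷ l0 ∷ []) ∷
  (l1 , (-[1+ 0 ] , + 1 , + 0) , l1 ∷ l0 ∷ l2 ∷ l0 ∷ []) ∷
  (l1 , (+ 0 , + 0 , + 0) , l0 ∷ l1 ∷ l0 ∷ l1 ∷ []) ∷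
  (l1 , (+ 0 , + 0 , + 0) , l0 ∷ l1 ∷ l0 ∷ l2 ∷ []) ∷
  (l1 , (+ 0 , + 1 , -[1+ 0 ]) , l0 ∷ l2 ∷ l0 ∷ l1 ∷ []) ∷
  (l2 , (-[1+ 0 ] , + 0 , + 1) , l0 ∷ l0 ∷ l1 ∷ l0 ∷ []) ∷
  (l2 , (-[1+ 0 ] , + 0 , + 1) , l1 ∷ l0 ∷ l0 ∷ l1 ∷ []) ∷
  (l2 , (-[1+ 0 ] , + 0 , + 1) , l1 ∷ l0 ∷ l1 ∷ l0 ∷ []) ∷
  (l2 , (-[1+ 0 ] , + 0 , + 1) , l2 ∷ l0 ∷ l1 ∷ l0 ∷ []) ∷
  (l2 , (+ 0 , + 0 , + 0) , l0 ∷ l1 ∷ l0 ∷ l2 ∷ []) ∷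
  (l2 , (+ 0 , + 0 , + 0) , l0 ∷ l2 ∷ l0 ∷ l1 ∷ []) ∷
  []

P1 : List State
P1 =
  (l0 , (+ 0 , -[1+ 0 ] , + 1) , l0 ∷ l1 ∷ l0 ∷ l0 ∷ l1 ∷ []) ∷
  (l0 , (+ 0 , -[1+ 0 ] , + 1) , l2 ∷ l0 ∷ l1 ∷ l0 ∷ l0 ∷ []) ∷
  (l0 , (+ 0 , -[1+ 0 ] , + 1) , l2 ∷ l0 ∷ l1 ∷ l0 ∷ l1 ∷ []) ∷
  (l0 , (+ 0 , -[1+ 0 ] , + 1) , l2 ∷ l0 ∷ l1 ∷ l0 ∷ l2 ∷ []) ∷
  (l0 , (+ 0 , + 0 , + 0) , l0 ∷ l0 ∷ l1 ∷ l0 ∷ l2 ∷ []) ∷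
  (l0 , (+ 0 , + 0 , + 0) , l0 ∷ l2 ∷ l0 ∷ l1 ∷ l0 ∷ []) ∷
  (l0 , (+ 0 , + 0 , + 0) , l1 ∷ l0 ∷ l0 ∷ l1 ∷ l0 ∷ []) ∷
  (l0 , (+ 0 , + 0 , + 0) , l1 ∷ l0 ∷ l1 ∷ l0 ∷ l2 ∷ []) ∷
  (l0 , (+ 0 , + 0 , + 0) , l1 ∷ l0 ∷ l2 ∷ l0 ∷ l1 ∷ []) ∷
  (l0 , (+ 0 , + 0 , + 0) , l2 ∷ l0 ∷ l1 ∷ l0 ∷ l0 ∷ []) ∷
  (l0 , (+ 0 , + 0 , + 0) , l2 ∷ l0 ∷ l1 ∷ l0 ∷ l2 ∷ []) ∷
  (l0 , (+ 1 , -[1+ 0 ] , + 0) , l0 ∷ l1 ∷ l0 ∷ l1 ∷ l0 ∷ []) ∷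
  (l0 , (+ 1 , -[1+ 0 ] , + 0) , l0 ∷ l1 ∷ l0 ∷ l2 ∷ l0 ∷ []) ∷
  (l0 , (+ 1 , -[1+ 0 ] , + 0) , l0 ∷ l2 ∷ l0 ∷ l1 ∷ l0 ∷ []) ∷
  (l0 , (+ 1 , + 0 , -[1+ 0 ]) , l0 ∷ l2 ∷ l0 ∷ l1 ∷ l0 ∷ []) ∷
  (l1 , (-[1+ 0 ] , + 0 , + 1) , l2 ∷ l0 ∷ l1 ∷ l0 ∷ l0 ∷ []) ∷
  (l1 , (+ 0 , + 0 , + 0) , l0 ∷ l0 ∷ l1 ∷ l0 ∷ l2 ∷ []) ∷
  (l1 , (+ 0 , + 0 , + 0) , l0 ∷ l1 ∷ l0 ∷ l0 ∷ l1 ∷ []) ∷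
  (l1 , (+ 0 , + 0 , + 0) , l0 ∷ l1 ∷ l0 ∷ l2 ∷ l0 ∷ []) ∷
  (l1 , (+ 0 , + 0 , + 0) , l0 ∷ l2 ∷ l0 ∷ l1 ∷ l0 ∷ []) ∷
  (l1 , (+ 0 , + 0 , + 0) , l1 ∷ l0 ∷ l1 ∷ l0 ∷ l2 ∷ []) ∷
  (l1 , (+ 0 , + 0 , + 0) , l1 ∷ l0 ∷ l2 ∷ l0 ∷ l1 ∷ []) ∷
  (l1 , (+ 0 , + 0 , + 0) , l2 ∷ l0 ∷ l1 ∷ l0 ∷ l1 ∷ []) ∷
  (l1 , (+ 0 , + 0 , + 0) , l2 ∷ l0 ∷ l1 ∷ l0 ∷ l2 ∷ []) ∷
  (l2 , (-[1+ 0 ] , + 0 , + 1) , l1 ∷ l0 ∷ l0 ∷ l1 ∷ l0 ∷ []) ∷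
  (l2 , (+ 0 , -[1+ 0 ] , + 1) , l0 ∷ l1 ∷ l0 ∷ l0 ∷ l1 ∷ []) ∷
  (l2 , (+ 0 , -[1+ 0 ] , + 1) , l0 ∷ l1 ∷ l0 ∷ l1 ∷ l0 ∷ []) ∷
  (l2 , (+ 0 , -[1+ 0 ] , + 1) , l0 ∷ l1 ∷ l0 ∷ l2 ∷ l0 ∷ []) ∷
  (l2 , (+ 0 , -[1+ 0 ] , + 1) , l2 ∷ l0 ∷ l1 ∷ l0 ∷ l1 ∷ []) ∷
  (l2 , (+ 0 , + 0 , + 0) , l0 ∷ l2 ∷ l0 ∷ l1 ∷ l0 ∷ []) ∷
  (l2 , (+ 0 , + 0 , + 0) , l1 ∷ l0 ∷ l2 ∷ l0 ∷ l1 ∷ []) ∷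
  []

P2 : List State
P2 =
  (l0 , (+ 0 , + 0 , + 0) , l0 ∷ l0 ∷ l1 ∷ l0 ∷ l2 ∷ []) ∷
  (l0 , (+ 0 , + 0 , + 0) , l0 ∷ l1 ∷ l0 ∷ l0 ∷ l1 ∷ []) ∷
  (l0 , (+ 0 , + 0 , + 0) , l1 ∷ l0 ∷ l0 ∷ l1 ∷ l0 ∷ []) ∷
  (l0 , (+ 0 , + 0 , + 0) , l1 ∷ l0 ∷ l1 ∷ l0 ∷ l2 ∷ []) ∷
  (l0 , (+ 0 , + 0 , + 0) , l1 ∷ l0 ∷ l2 ∷ l0 ∷ l1 ∷ []) ∷
  (l0 , (+ 0 , + 0 , + 0) , l2 ∷ l0 ∷ l1 ∷ l0 ∷ l0 ∷ []) ∷
  (l0 , (+ 0 , + 0 , + 0) , l2 ∷ l0 ∷ l1 ∷ l0 ∷ l1 ∷ []) ∷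
  (l0 , (+ 0 , + 0 , + 0) , l2 ∷ l0 ∷ l1 ∷ l0 ∷ l2 ∷ []) ∷
  (l0 , (+ 0 , + 1 , -[1+ 0 ]) , l1 ∷ l0 ∷ l0 ∷ l1 ∷ l0 ∷ []) ∷
  (l0 , (+ 0 , + 1 , -[1+ 0 ]) , l1 ∷ l0 ∷ l2 ∷ l0 ∷ l1 ∷ []) ∷
  (l0 , (+ 1 , -[1+ 0 ] , + 0) , l0 ∷ l1 ∷ l0 ∷ l1 ∷ l0 ∷ []) ∷
  (l0 , (+ 1 , -[1+ 0 ] , + 0) , l0 ∷ l1 ∷ l0 ∷ l2 ∷ l0 ∷ []) ∷
  (l0 , (+ 1 , + 0 , -[1+ 0 ]) , l0 ∷ l1 ∷ l0 ∷ l2 ∷ l0 ∷ []) ∷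
  (l0 , (+ 1 , + 0 , -[1+ 0 ]) , l0 ∷ l2 ∷ l0 ∷ l1 ∷ l0 ∷ []) ∷
  (l1 , (-[1+ 0 ] , + 1 , + 0) , l1 ∷ l0 ∷ l0 ∷ l1 ∷ l0 ∷ []) ∷
  (l1 , (+ 0 , + 0 , + 0) , l0 ∷ l0 ∷ l1 ∷ l0 ∷ l2 ∷ []) ∷
  (l1 , (+ 0 , + 0 , + 0) , l0 ∷ l1 ∷ l0 ∷ l0 ∷ l1 ∷ []) ∷
  (l1 , (+ 0 , + 0 , + 0) , l0 ∷ l1 ∷ l0 ∷ l1 ∷ l0 ∷ []) ∷
  (l1 , (+ 0 , + 0 , + 0) , l0 ∷ l1 ∷ l0 ∷ l2 ∷ l0 ∷ []) ∷
  (l1 , (+ 0 , + 0 , + 0) , l2 ∷ l0 ∷ l1 ∷ l0 ∷ l1 ∷ []) ∷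
  (l1 , (+ 0 , + 1 , -[1+ 0 ]) , l0 ∷ l0 ∷ l1 ∷ l0 ∷ l2 ∷ []) ∷
  (l1 , (+ 0 , + 1 , -[1+ 0 ]) , l0 ∷ l2 ∷ l0 ∷ l1 ∷ l0 ∷ []) ∷
  (l1 , (+ 0 , + 1 , -[1+ 0 ]) , l1 ∷ l0 ∷ l2 ∷ l0 ∷ l1 ∷ []) ∷
  (l2 , (+ 0 , + 0 , + 0) , l0 ∷ l0 ∷ l1 ∷ l0 ∷ l2 ∷ []) ∷
  (l2 , (+ 0 , + 0 , + 0) , l0 ∷ l1 ∷ l0 ∷ l0 ∷ l1 ∷ []) ∷
  (l2 , (+ 0 , + 0 , + 0) , l0 ∷ l1 ∷ l0 ∷ l2 ∷ l0 ∷ []) ∷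
  (l2 , (+ 0 , + 0 , + 0) , l0 ∷ l2 ∷ l0 ∷ l1 ∷ l0 ∷ []) ∷
  (l2 , (+ 0 , + 0 , + 0) , l1 ∷ l0 ∷ l2 ∷ l0 ∷ l1 ∷ []) ∷
  []

P3 : List State
P3 =
  (l0 , (+ 0 , -[1+ 0 ] , + 1) , l0 ∷ l1 ∷ l0 ∷ l0 ∷ l1 ∷ []) ∷
  (l0 , (+ 0 , -[1+ 0 ] , + 1) , l0 ∷ l1 ∷ l0 ∷ l1 ∷ l0 ∷ []) ∷
  (l0 , (+ 0 , -[1+ 0 ] , + 1) , l2 ∷ l0 ∷ l1 ∷ l0 ∷ l1 ∷ []) ∷
  (l0 , (+ 0 , + 0 , + 0) , l0 ∷ l0 ∷ l1 ∷ l0 ∷ l2 ∷ []) ∷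
  (l0 , (+ 0 , + 0 , + 0) , l0 ∷ l1 ∷ l0 ∷ l0 ∷ l1 ∷ []) ∷
  (l0 , (+ 0 , + 0 , + 0) , l0 ∷ l1 ∷ l0 ∷ l2 ∷ l0 ∷ []) ∷
  (l0 , (+ 0 , + 0 , + 0) , l0 ∷ l2 ∷ l0 ∷ l1 ∷ l0 ∷ []) ∷
  (l0 , (+ 0 , + 0 , + 0) , l1 ∷ l0 ∷ l0 ∷ l1 ∷ l0 ∷ []) ∷
  (l0 , (+ 0 , + 0 , + 0) , l1 ∷ l0 ∷ l1 ∷ l0 ∷ l2 ∷ []) ∷
  (l0 , (+ 0 , + 0 , + 0) , l1 ∷ l0 ∷ l2 ∷ l0 ∷ l1 ∷ []) ∷
  (l0 , (+ 0 , + 0 , + 0) , l2 ∷ l0 ∷ l1 ∷ l0 ∷ l0 ∷ []) ∷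
  (l0 , (+ 0 , + 0 , + 0) , l2 ∷ l0 ∷ l1 ∷ l0 ∷ l1 ∷ []) ∷
  (l0 , (+ 0 , + 0 , + 0) , l2 ∷ l0 ∷ l1 ∷ l0 ∷ l2 ∷ []) ∷
  (l0 , (+ 0 , + 1 , -[1+ 0 ]) , l1 ∷ l0 ∷ l2 ∷ l0 ∷ l1 ∷ []) ∷
  (l1 , (-[1+ 0 ] , + 0 , + 1) , l2 ∷ l0 ∷ l1 ∷ l0 ∷ l0 ∷ []) ∷
  (l1 , (-[1+ 0 ] , + 0 , + 1) , l2 ∷ l0 ∷ l1 ∷ l0 ∷ l1 ∷ []) ∷
  (l1 , (-[1+ 0 ] , + 1 , + 0) , l1 ∷ l0 ∷ l0 ∷ l1 ∷ l0 ∷ []) ∷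
  (l1 , (-[1+ 0 ] , + 1 , + 0) , l1 ∷ l0 ∷ l2 ∷ l0 ∷ l1 ∷ []) ∷
  (l1 , (+ 0 , + 0 , + 0) , l0 ∷ l1 ∷ l0 ∷ l0 ∷ l1 ∷ []) ∷
  (l1 , (+ 0 , + 0 , + 0) , l0 ∷ l1 ∷ l0 ∷ l1 ∷ l0 ∷ []) ∷
  (l1 , (+ 0 , + 0 , + 0) , l0 ∷ l1 ∷ l0 ∷ l2 ∷ l0 ∷ []) ∷
  (l1 , (+ 0 , + 0 , + 0) , l0 ∷ l2 ∷ l0 ∷ l1 ∷ l0 ∷ []) ∷
  (l1 , (+ 0 , + 1 , -[1+ 0 ]) , l0 ∷ l2 ∷ l0 ∷ l1 ∷ l0 ∷ []) ∷
  (l2 , (-[1+ 0 ] , + 0 , + 1) , l1 ∷ l0 ∷ l0 ∷ l1 ∷ l0 ∷ []) ∷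
  (l2 , (-[1+ 0 ] , + 0 , + 1) , l1 ∷ l0 ∷ l1 ∷ l0 ∷ l2 ∷ []) ∷
  (l2 , (-[1+ 0 ] , + 0 , + 1) , l2 ∷ l0 ∷ l1 ∷ l0 ∷ l0 ∷ []) ∷
  (l2 , (+ 0 , -[1+ 0 ] , + 1) , l0 ∷ l1 ∷ l0 ∷ l1 ∷ l0 ∷ []) ∷
  (l2 , (+ 0 , + 0 , + 0) , l0 ∷ l1 ∷ l0 ∷ l2 ∷ l0 ∷ []) ∷
  (l2 , (+ 0 , + 0 , + 0) , l0 ∷ l2 ∷ l0 ∷ l1 ∷ l0 ∷ []) ∷
  []

PR : List State
PR =
  (l0 , (+ 0 , -[1+ 0 ] , + 1) , l0 ∷ l1 ∷ l0 ∷ l0 ∷ l1 ∷ []) ∷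
  (l0 , (+ 0 , -[1+ 0 ] , + 1) , l2 ∷ l0 ∷ l1 ∷ l0 ∷ l0 ∷ []) ∷
  (l0 , (+ 0 , -[1+ 0 ] , + 1) , l2 ∷ l0 ∷ l1 ∷ l0 ∷ l1 ∷ []) ∷
  (l0 , (+ 0 , + 0 , + 0) , l0 ∷ l0 ∷ l1 ∷ l0 ∷ l2 ∷ []) ∷
  (l0 , (+ 0 , + 0 , + 0) , l0 ∷ l2 ∷ l0 ∷ l1 ∷ l0 ∷ []) ∷
  (l0 , (+ 0 , + 0 , + 0) , l1 ∷ l0 ∷ l0 ∷ l1 ∷ l0 ∷ []) ∷
  (l0 , (+ 0 , + 0 , + 0) , l1 ∷ l0 ∷ l1 ∷ l0 ∷ l2 ∷ []) ∷
  (l0 , (+ 0 , + 0 , + 0) , l1 ∷ l0 ∷ l2 ∷ l0 ∷ l1 ∷ []) ∷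
  (l0 , (+ 0 , + 0 , + 0) , l2 ∷ l0 ∷ l1 ∷ l0 ∷ l0 ∷ []) ∷
  (l0 , (+ 0 , + 0 , + 0) , l2 ∷ l0 ∷ l1 ∷ l0 ∷ l1 ∷ []) ∷
  (l0 , (+ 0 , + 0 , + 0) , l2 ∷ l0 ∷ l1 ∷ l0 ∷ l2 ∷ []) ∷
  (l0 , (+ 1 , -[1+ 0 ] , + 0) , l0 ∷ l1 ∷ l0 ∷ l1 ∷ l0 ∷ []) ∷
  (l0 , (+ 1 , -[1+ 0 ] , + 0) , l0 ∷ l1 ∷ l0 ∷ l2 ∷ l0 ∷ []) ∷
  (l0 , (+ 1 , + 0 , -[1+ 0 ]) , l0 ∷ l1 ∷ l0 ∷ l2 ∷ l0 ∷ []) ∷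
  (l0 , (+ 1 , + 0 , -[1+ 0 ]) , l0 ∷ l2 ∷ l0 ∷ l1 ∷ l0 ∷ []) ∷
  (l1 , (-[1+ 0 ] , + 0 , + 1) , l2 ∷ l0 ∷ l1 ∷ l0 ∷ l0 ∷ []) ∷
  (l1 , (+ 0 , + 0 , + 0) , l0 ∷ l0 ∷ l1 ∷ l0 ∷ l2 ∷ []) ∷
  (l1 , (+ 0 , + 0 , + 0) , l0 ∷ l1 ∷ l0 ∷ l0 ∷ l1 ∷ []) ∷
  (l1 , (+ 0 , + 0 , + 0) , l0 ∷ l1 ∷ l0 ∷ l1 ∷ l0 ∷ []) ∷
  (l1 , (+ 0 , + 0 , + 0) , l0 ∷ l1 ∷ l0 ∷ l2 ∷ l0 ∷ []) ∷
  (l1 , (+ 0 , + 0 , + 0) , l0 ∷ l2 ∷ l0 ∷ l1 ∷ l0 ∷ []) ∷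
  (l1 , (+ 0 , + 0 , + 0) , l2 ∷ l0 ∷ l1 ∷ l0 ∷ l1 ∷ []) ∷
  (l1 , (+ 0 , + 0 , + 0) , l2 ∷ l0 ∷ l1 ∷ l0 ∷ l2 ∷ []) ∷
  (l1 , (+ 0 , + 1 , -[1+ 0 ]) , l1 ∷ l0 ∷ l2 ∷ l0 ∷ l1 ∷ []) ∷
  (l2 , (-[1+ 0 ] , + 0 , + 1) , l1 ∷ l0 ∷ l0 ∷ l1 ∷ l0 ∷ []) ∷
  (l2 , (+ 0 , -[1+ 0 ] , + 1) , l0 ∷ l1 ∷ l0 ∷ l0 ∷ l1 ∷ []) ∷
  (l2 , (+ 0 , -[1+ 0 ] , + 1) , l0 ∷ l1 ∷ l0 ∷ l1 ∷ l0 ∷ []) ∷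
  (l2 , (+ 0 , + 0 , + 0) , l0 ∷ l0 ∷ l1 ∷ l0 ∷ l2 ∷ []) ∷
  (l2 , (+ 0 , + 0 , + 0) , l0 ∷ l2 ∷ l0 ∷ l1 ∷ l0 ∷ []) ∷
  (l2 , (+ 0 , + 0 , + 0) , l1 ∷ l0 ∷ l2 ∷ l0 ∷ l1 ∷ []) ∷
  []


factors4-closed : All (ImagesIn 4 factors4) factors4
factors4-closed = from-yes (all? (images-in? 4 factors4) factors4)

factors4-initial : All (InitialIn P0) factors4
factors4-initial = from-yes (all? (initial-in? P0) factors4)

P0-steps : All (StepsInto P1) P0
P0-steps = from-yes (all? (steps-into? P1) P0)

P1-steps : All (StepsInto P2) P1
P1-steps = from-yes (all? (steps-into? P2) P1)

P2-steps : All (StepsInto P3) P2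
P2-steps = from-yes (all? (steps-into? P3) P2)

P3-steps : All (StepsInto PR) P3
P3-steps = from-yes (all? (steps-into? PR) P3)

PR-extends : All (λ σ → Lands (_∈ P0) (extend σ)) PR
PR-extends = from-yes (all? (extends-into? P0) PR)

windows4 : ∀ p → ∃[ w ] (w ∈ factors4 × OccursAt p w)
windows4 = windows 4 factors4 factors4-closed
  (l0 ∷ l1 ∷ l0 ∷ l2 ∷ [] , from-yes ((l0 ∷ l1 ∷ l0 ∷ l2 ∷ []) ∈ʷ? factors4) , refl)

covers-P0 : ∀ i → Covers P0 (suc (M i))
covers-PR : ∀ i → Covers PR (M (suc i))

covers-P0 zero    = cover-initial windows4 factors4-initial
covers-P0 (suc i) = cover-extend PR-extends (occurs-0-at-M (suc i)) (covers-PR i)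

covers-PR i = subst (Covers PR) (length-Mword (suc i))
  (cover-step P3-steps (prefix-image 2) (cover-step P2-steps (prefix-image 1)
    (cover-step P1-steps (prefix-image 0) (cover-step P0-steps (prefix-suc-M i) (covers-P0 i)))))
  where
  prefix-image : ∀ k → prefix (length (φ* (suc k) (Mword i ++ zero ∷ []))) ≡ φ* (suc k) (Mword i ++ zero ∷ [])
  prefix-image k = IsTPrefix-φ* (suc k) (Mword-0 i)

-- Reaching length M_3 from the initial state of a window: four steps lead
-- from length 1 = M_0 + 1 to M_1, then two rounds to M_3.
fromStart : Letter → List Letter → Vec ℕ 4 → Vec ℕ 4 → Vec ℕ 4 → Maybe State
fromStart a w rs₁ rs₂ rs₃ = run (initial a w) rs₁ >>= λ σ₁ → round σ₁ rs₂ >>= λ σ₂ → round σ₂ rs₃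

bind-just : ∀ {m : Maybe State} {f : State → Maybe State} {y} → (m >>= f) ≡ just y →
  ∃[ x ] (m ≡ just x × f x ≡ just y)
bind-just {just x} eq = x , refl , eq

fromStart-sound : ∀ q a w rs₁ rs₂ rs₃ {σ} → OccursAt q (a ∷ w) → fromStart a w rs₁ rs₂ rs₃ ≡ just σ →
  ∃[ q' ] Describes q' (M 3) σ
fromStart-sound q a w rs₁ rs₂ rs₃ h reached with bind-just {run (initial a w) rs₁} reached
... | σ₁ , ran , rest with bind-just {round σ₁ rs₂} rest
...   | σ₂ , round₂ , round₃ with run-from-M 0 rs₁ q (initial-describes q a w h) ran
...     | q₁ , d₁ with round-sound 1 rs₂ q₁ d₁ round₂
...       | q₂ , d₂ = round-sound 2 rs₃ q₂ d₂ round₃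

-- A witness that a state σ describes factors of every length M_i, i ≥ 3:
-- σ is reached from the initial state of the window a w at position
-- 'start' (giving length M_3), and by one round from the witness state
-- 'previous' (passing from M_i to M_{i+1}).
record Witness : Set where
  constructor witness
  field
    state       : State
    start       : ℕ
    startWindow : Letter × List Letter
    offsets₁    : Vec ℕ 4
    offsets₂    : Vec ℕ 4
    offsets₃    : Vec ℕ 4
    previous    : State
    offsets     : Vec ℕ 4

Valid : List State → Witness → Set
Valid W (witness σ q (a , w) rs₁ rs₂ rs₃ σₚ rs) =
  OccursAt q (a ∷ w) × fromStart a w rs₁ rs₂ rs₃ ≡ just σ × σₚ ∈ W × round σₚ rs ≡ just σ

valid? : ∀ W t → Dec (Valid W t)
valid? W (witness σ q (a , w) rs₁ rs₂ rs₃ σₚ rs) =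
  ≡-dec-List _≟ˡ_ _ _ ×-dec ≡-dec-Maybe _≟ˢ_ _ _ ×-dec σₚ ∈ˢ? W ×-dec ≡-dec-Maybe _≟ˢ_ _ _

witnessTable : List Witness
witnessTable =
  witness (l1 , (-[1+ 0 ] , + 0 , + 1) , l2 ∷ l0 ∷ l1 ∷ l0 ∷ l0 ∷ [])
    1 (l1 , l0 ∷ l2 ∷ l0 ∷ []) (0 ∷ 0 ∷ 1 ∷ 0 ∷ []) (0 ∷ 1 ∷ 0 ∷ 0 ∷ []) (1 ∷ 0 ∷ 0 ∷ 1 ∷ [])
    (l0 , (+ 1 , + 0 , -[1+ 0 ]) , l0 ∷ l1 ∷ l0 ∷ l2 ∷ l0 ∷ []) (1 ∷ 0 ∷ 0 ∷ 1 ∷ []) ∷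
  witness (l0 , (+ 1 , + 0 , -[1+ 0 ]) , l0 ∷ l1 ∷ l0 ∷ l2 ∷ l0 ∷ [])
    0 (l0 , l1 ∷ l0 ∷ l2 ∷ []) (0 ∷ 0 ∷ 0 ∷ 1 ∷ []) (0 ∷ 0 ∷ 1 ∷ 0 ∷ []) (0 ∷ 1 ∷ 0 ∷ 0 ∷ [])
    (l0 , (+ 0 , -[1+ 0 ] , + 1) , l2 ∷ l0 ∷ l1 ∷ l0 ∷ l0 ∷ []) (0 ∷ 1 ∷ 0 ∷ 0 ∷ []) ∷
  witness (l0 , (+ 0 , -[1+ 0 ] , + 1) , l2 ∷ l0 ∷ l1 ∷ l0 ∷ l0 ∷ [])
    0 (l0 , l1 ∷ l0 ∷ l2 ∷ []) (1 ∷ 1 ∷ 0 ∷ 0 ∷ []) (0 ∷ 0 ∷ 0 ∷ 1 ∷ []) (0 ∷ 0 ∷ 1 ∷ 0 ∷ [])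
    (l1 , (-[1+ 0 ] , + 0 , + 1) , l2 ∷ l0 ∷ l1 ∷ l0 ∷ l0 ∷ []) (1 ∷ 0 ∷ 1 ∷ 0 ∷ []) ∷
  witness (l1 , (+ 0 , + 1 , -[1+ 0 ]) , l1 ∷ l0 ∷ l2 ∷ l0 ∷ l1 ∷ [])
    0 (l0 , l1 ∷ l0 ∷ l2 ∷ []) (0 ∷ 0 ∷ 0 ∷ 1 ∷ []) (0 ∷ 0 ∷ 1 ∷ 0 ∷ []) (0 ∷ 1 ∷ 0 ∷ 1 ∷ [])
    (l0 , (+ 0 , -[1+ 0 ] , + 1) , l2 ∷ l0 ∷ l1 ∷ l0 ∷ l0 ∷ []) (0 ∷ 1 ∷ 0 ∷ 1 ∷ []) ∷
  witness (l0 , (+ 1 , -[1+ 0 ] , + 0) , l0 ∷ l1 ∷ l0 ∷ l1 ∷ l0 ∷ [])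
    0 (l0 , l1 ∷ l0 ∷ l2 ∷ []) (1 ∷ 1 ∷ 0 ∷ 0 ∷ []) (0 ∷ 0 ∷ 1 ∷ 1 ∷ []) (0 ∷ 1 ∷ 1 ∷ 0 ∷ [])
    (l0 , (+ 0 , + 0 , + 0) , l0 ∷ l2 ∷ l0 ∷ l1 ∷ l0 ∷ []) (0 ∷ 1 ∷ 1 ∷ 0 ∷ []) ∷
  witness (l0 , (+ 0 , + 0 , + 0) , l0 ∷ l2 ∷ l0 ∷ l1 ∷ l0 ∷ [])
    1 (l1 , l0 ∷ l2 ∷ l0 ∷ []) (0 ∷ 0 ∷ 1 ∷ 0 ∷ []) (0 ∷ 1 ∷ 0 ∷ 0 ∷ []) (1 ∷ 0 ∷ 0 ∷ 0 ∷ [])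
    (l0 , (+ 1 , + 0 , -[1+ 0 ]) , l0 ∷ l1 ∷ l0 ∷ l2 ∷ l0 ∷ []) (1 ∷ 0 ∷ 0 ∷ 0 ∷ []) ∷
  witness (l0 , (+ 0 , -[1+ 0 ] , + 1) , l0 ∷ l1 ∷ l0 ∷ l0 ∷ l1 ∷ [])
    1 (l1 , l0 ∷ l2 ∷ l0 ∷ []) (0 ∷ 0 ∷ 1 ∷ 0 ∷ []) (0 ∷ 1 ∷ 0 ∷ 0 ∷ []) (1 ∷ 0 ∷ 1 ∷ 0 ∷ [])
    (l0 , (+ 1 , + 0 , -[1+ 0 ]) , l0 ∷ l1 ∷ l0 ∷ l2 ∷ l0 ∷ []) (1 ∷ 0 ∷ 1 ∷ 0 ∷ []) ∷
  witness (l0 , (+ 0 , + 0 , + 0) , l0 ∷ l0 ∷ l1 ∷ l0 ∷ l2 ∷ [])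
    0 (l0 , l1 ∷ l0 ∷ l2 ∷ []) (1 ∷ 1 ∷ 0 ∷ 0 ∷ []) (1 ∷ 1 ∷ 0 ∷ 0 ∷ []) (1 ∷ 0 ∷ 0 ∷ 0 ∷ [])
    (l0 , (+ 0 , + 0 , + 0) , l0 ∷ l0 ∷ l1 ∷ l0 ∷ l2 ∷ []) (1 ∷ 0 ∷ 0 ∷ 0 ∷ []) ∷
  []

witnessStates : List State
witnessStates = map Witness.state witnessTable

witnesses-valid : All (Valid witnessStates) witnessTable
witnesses-valid = from-yes (all? (valid? witnessStates) witnessTable)

witnessed : ∀ k {σ} → σ ∈ witnessStates → ∃[ q ] Describes q (M (3 + k)) σ
valid-witnessed : ∀ k t → Valid witnessStates t → ∃[ q ] Describes q (M (3 + k)) (Witness.state t)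

witnessed k σ∈ with ∈-map⁻ Witness.state σ∈
... | t , t∈ , refl = valid-witnessed k t (All-lookup witnesses-valid t∈)

valid-witnessed zero    (witness σ q (a , w) rs₁ rs₂ rs₃ σₚ rs) (h , reached , _ , _) =
  fromStart-sound q a w rs₁ rs₂ rs₃ h reached
valid-witnessed (suc k) (witness σ q (a , w) rs₁ rs₂ rs₃ σₚ rs) (_ , _ , σₚ∈ , stepped) with witnessed k σₚ∈
... | q′ , d = round-sound (3 + k) rs q′ d stepped

PR-in-six : All (λ σ → relOf σ ∈ six) PR
PR-in-six = from-yes (all? (λ σ → DecMembership._∈?_ _≟ᵛ_ (relOf σ) six) PR)

six-witnessed : All (λ v → Any (λ σ → relOf σ ≡ v) witnessStates) six
six-witnessed = from-yes (all? (λ v → any? (λ σ → relOf σ ≟ᵛ v) witnessStates) six)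

six-unique : Unique six
six-unique = from-yes (DecUnique.unique? _≟ᵛ_ six)

relative-M : ∀ k v → InPrel (M (3 + k)) v ⇔ (v ∈ six)
relative-M k v = mk⇔ to from
  where
  n : ℕ
  n = M (3 + k)
  to : InPrel n v → v ∈ six
  to (w , (q , refl) , refl) = in-six (covers-PR (2 + k) q)
    where
    in-six : ∃[ σ ] (σ ∈ PR × Describes q n σ) → Ψrel (factorAt q n) ∈ six
    in-six (σ , σ∈PR , d) = subst (_∈ six) (sym (relative-vector q n σ d)) (All-lookup PR-in-six σ∈PR)
  from : v ∈ six → InPrel n v
  from v∈six = carried (find (All-lookup six-witnessed v∈six))
    where
    carried : ∃[ σ ] (σ ∈ witnessStates × relOf σ ≡ v) → InPrel n v
    carried (σ , σ∈ , refl) = occurs (witnessed k σ∈)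
      where
      occurs : ∃[ q ] Describes q n σ → InPrel n (relOf σ)
      occurs (q , d) = factorAt q n , (q , refl) , relative-vector q n σ d

corollary7p6 :
    ((i : ℕ) → 3 ≤ i → (∀ v → InPrel (M i) v ⇔ (v ∈ six)) × AC≡ (M i) 6)
    × ((N : ℕ) → ∃[ n ] (N ≤ n × AC≡ n 6))
corollary7p6 = at-M , unbounded
  where
  six-at-M : ∀ k → AC≡ (M (3 + k)) 6
  six-at-M k = abelian-complexity (M (3 + k)) six six-unique (relative-M k)
  at-M : (i : ℕ) → 3 ≤ i → (∀ v → InPrel (M i) v ⇔ (v ∈ six)) × AC≡ (M i) 6
  at-M (suc (suc (suc k))) (s≤s (s≤s (s≤s z≤n))) = relative-M k , six-at-M k
  unbounded : (N : ℕ) → ∃[ n ] (N ≤ n × AC≡ n 6)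
  unbounded N = M (3 + N) , ≤-trans (m≤n+m N 3) (M-grows (3 + N)) , six-at-M N
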